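{- Let $S$ be a semiring that is positive, refinable and satisfies properties (B) and (E). Then the family $\delta=(\delta_X)_X$ defined for all sets $X$ and $\Phi\in\mathcal S\mathcal PX$ by \[ \delta_X(\Phi)=\Bigl\{\phi\in\mathcal SX\ \Bigm|\ \exists\psi\in\mathcal S(\ni_X).\ \forall A\in\mathcal PX.\ \Phi(A)=\sum_{x\in A}\psi(A,x),\ \ \forall x\in X.\ \phi(x)=\sum_{A\ni x}\psi(A,x)\Bigr\} \] is a weak distributive law $\delta\colon\mathcal S\mathcal P\to\mathcal P\mathcal S$ (namely the canonical one, arising from the unique extension of the functor $\mathcal S$ and of $\mu^{\mathcal S}$ to locally monotone structure on the category of sets and relations).
   Context: Properties of a semiring $S$: positive: $a+b=0\Rightarrow a=b=0$; refinable: $a+b=c+d$ implies there are $x,y,z,t$ with $x+y=a$, $z+t=b$, $x+z=c$, $y+t=d$; (B): $a\cdot b=0\Rightarrow a=0$ or $b=0$; (E): if $a+b=c\cdot d$ then there is $t\colon\{(x,y)\in S^2\mid x+y=d\}\to S$ with $\sum_{x+y=d}t(x,y)x=a$, $\sum_{x+y=d}t(x,y)y=b$, $\sum_{x+y=d}t(x,y)=c$. $\mathcal S$ is the monad on Set with $\mathcal SX$ the finitely supported $\phi\colon X\to S$, $\mathcal S(f)(\phi)(y)=\sum_{x\in f^{ -1}\{y\}}\phi(x)$, unit $x\mapsto\Delta_x$, multiplication $\mu^{\mathcal S}_X(\Psi)(x)=\sum_{\phi\in\mathrm{supp}\Psi}\Psi(\phi)\phi(x)$. $\mathcal P$ is the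 powerset monad (unit singleton, multiplication union). $\ni_X=\{(A,x)\in\mathcal PX\times X\mid x\in A\}$. A weak distributive law of $\mathcal P$ over $\mathcal S$ is a natural transformation $\delta\colon\mathcal S\mathcal P\to\mathcal P\mathcal S$ with $\delta\circ\mathcal S\mu^{\mathcal P}=\mu^{\mathcal P}\mathcal S\circ\mathcal P\delta\circ\delta\mathcal P$, $\delta\circ\mu^{\mathcal S}\mathcal P=\mathcal P\mu^{\mathcal S}\circ\delta\mathcal S\circ\mathcal S\delta$, and $\delta\circ\mathcal S\eta^{\mathcal P}=\eta^{\mathcal P}\mathcal S$. -}

module Defs where

open import Level using (0ℓ)
open import Data.Bool using (Bool; true; false)
open import Data.Empty using (⊥; ⊥-elim)
open import Data.Product using (Σ; ∃; _×_; _,_; proj₁; proj₂; ∃-syntax)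
open import Data.Sum using (_⊎_)
open import Data.List using (List; []; _∷_; foldr; map; concatMap; deduplicate; [_])
open import Data.List.Membership.Propositional using (_∈_; _∉_)
open import Data.List.Membership.Propositional.Properties using (∈-map⁺; ∈-concatMap⁺)
open import Data.List.Relation.Unary.Any using (here)
import Data.List.Relation.Unary.Any as Any
open import Relation.Nullary using (¬_; Dec; yes; no)
open import Relation.Nullary.Decidable using (⌊_⌋)
open import Relation.Binary.PropositionalEquality using (_≡_; refl; sym; trans; cong)
open import Algebra.Core using (Op₂)
open import Algebra.Structures using (IsSemiring)
open import Axiom.ExcludedMiddle using (ExcludedMiddle)

module Semiring-Monads
  {S : Set} {_+_ _*_ : Op₂ S} {0# 1# : S}
  (isSR : IsSemiring _≡_ _+_ _*_ 0# 1#)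
  (lem : ExcludedMiddle 0ℓ)
  where

  open IsSemiring isSR using (+-identityˡ; zeroˡ; zeroʳ)

  _≟_ : {A : Set} (a b : A) → Dec (a ≡ b)
  a ≟ b = lem

  ¬¬-elim : {P : Set} → ¬ ¬ P → P
  ¬¬-elim {P} nnp with lem {P}
  ... | yes p = p
  ... | no ¬p = ⊥-elim (nnp ¬p)

  ⟦_⟧ : Set → Bool
  ⟦ P ⟧ = ⌊ lem {P} ⌋

  𝒫 : Set → Set
  𝒫 X = X → Bool

  𝒫map : {X Y : Set} → (X → Y) → 𝒫 X → 𝒫 Y
  𝒫map f A y = ⟦ ∃[ x ] (A x ≡ true × f x ≡ y) ⟧

  η𝒫 : {X : Set} → X → 𝒫 X
  η𝒫 x y = ⟦ x ≡ y ⟧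

  μ𝒫 : {X : Set} → 𝒫 (𝒫 X) → 𝒫 X
  μ𝒫 𝒜 x = ⟦ ∃[ A ] (𝒜 A ≡ true × A x ≡ true) ⟧

  ∋ : Set → Set
  ∋ X = Σ (𝒫 X × X) (λ p → proj₁ p (proj₂ p) ≡ true)

  -- Finiteness of the support is stated (double-negated, hence
  -- propositional) as existence of a finite list outside of which the
  -- function vanishes.

  FinSupp : {X : Set} → (X → S) → Set
  FinSupp {X} φ = ¬ ¬ (Σ (List X) λ l → ∀ x → x ∉ l → φ x ≡ 0#)

  record 𝒮 (X : Set) : Set where
    constructor mk𝒮
    field
      fun : X → S
      fin : FinSupp fun
  open 𝒮 public

  suppList : {X : Set} → 𝒮 X → List X
  suppList φ = proj₁ (¬¬-elim (fin φ))

  suppList-ok : {X : Set} (φ : 𝒮 X) → ∀ x → x ∉ suppList φ → fun φ x ≡ 0#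
  suppList-ok φ = proj₂ (¬¬-elim (fin φ))

  supp : {X : Set} → 𝒮 X → List X
  supp φ = deduplicate _≟_ (suppList φ)

  sumSupp : {X : Set} → 𝒮 X → (X → S) → S
  sumSupp φ g = foldr (λ y acc → g y + acc) 0# (supp φ)

  private
    sum0 : {X : Set} (g : X → S) → (∀ y → g y ≡ 0#) → (l : List X) →
           foldr (λ y acc → g y + acc) 0# l ≡ 0#
    sum0 g h [] = refl
    sum0 g h (y ∷ l) rewrite h y | sum0 g h l = +-identityˡ 0#

    _∈?_ : {X : Set} (x : X) (l : List X) → Dec (x ∈ l)
    x ∈? l = lem

  fibre : {X Y : Set} → (X → Y) → (X → S) → Y → X → S
  fibre f φ y x with f x ≟ y
  ... | yes _ = φ x
  ... | no _ = 0#

  𝒮map : {X Y : Set} → (X → Y) → 𝒮 X → 𝒮 Y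
  𝒮map {X} {Y} f φ = mk𝒮 (λ y → sumSupp φ (fibre f (fun φ) y)) fin′
    where
    zt : (L : List X) → (∀ x → x ∉ L → fun φ x ≡ 0#) →
         ∀ y → y ∉ map f L → ∀ x → fibre f (fun φ) y x ≡ 0#
    zt L hL y y∉ x with f x ≟ y
    ... | no _ = refl
    ... | yes refl with x ∈? L
    ...   | yes x∈ = ⊥-elim (y∉ (∈-map⁺ f x∈))
    ...   | no x∉ = hL x x∉
    fin′ : FinSupp (λ y → sumSupp φ (fibre f (fun φ) y))
    fin′ k = fin φ (λ { (L , hL) →
      k (map f L , λ y y∉ → sum0 _ (zt L hL y y∉) (supp φ)) })

  η𝒮 : {X : Set} → X → 𝒮 X
  η𝒮 {X} x = mk𝒮 Δ fin′
    where
    Δ : X → S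
    Δ y with x ≟ y
    ... | yes _ = 1#
    ... | no _ = 0#
    fin′ : FinSupp Δ
    fin′ k = k ([ x ] , z)
      where
      z : ∀ y → y ∉ [ x ] → Δ y ≡ 0#
      z y y∉ with x ≟ y
      ... | yes refl = ⊥-elim (y∉ (here refl))
      ... | no _ = refl

  μ𝒮 : {X : Set} → 𝒮 (𝒮 X) → 𝒮 X
  μ𝒮 {X} Ψ = mk𝒮 m fin′
    where
    m : X → S
    m x = sumSupp Ψ (λ φ → fun Ψ φ * fun φ x)
    zt : (L : List (𝒮 X)) → (∀ φ → φ ∉ L → fun Ψ φ ≡ 0#) →
         ∀ x → x ∉ concatMap suppList L → ∀ φ → fun Ψ φ * fun φ x ≡ 0#
    zt L hL x x∉ φ with φ ∈? L
    ... | no φ∉ rewrite hL φ φ∉ = zeroˡ (fun φ x)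
    ... | yes φ∈ with x ∈? suppList φ
    ...   | yes x∈ = ⊥-elim (x∉ (∈-concatMap⁺ suppList (Any.map (λ { refl → x∈ }) φ∈)))
    ...   | no x∉′ rewrite suppList-ok φ x x∉′ = zeroʳ (fun Ψ φ)
    fin′ : FinSupp m
    fin′ k = fin Ψ (λ { (L , hL) →
      k (concatMap suppList L , λ x x∉ → sum0 _ (zt L hL x x∉) (supp Ψ)) })

  Positive : Set
  Positive = ∀ a b → a + b ≡ 0# → a ≡ 0# × b ≡ 0#

  Refinable : Set
  Refinable = ∀ a b c d → a + b ≡ c + d →
    ∃[ x ] ∃[ y ] ∃[ z ] ∃[ t ]
      (x + y ≡ a × z + t ≡ b × x + z ≡ c × y + t ≡ d)

  PropB : Set
  PropB = ∀ a b → a * b ≡ 0# → a ≡ 0# ⊎ b ≡ 0#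

  Split : S → Set
  Split d = Σ (S × S) (λ p → proj₁ p + proj₂ p ≡ d)

  PropE : Set
  PropE = ∀ a b c d → a + b ≡ c * d →
    ∃[ t ] ( sumSupp {Split d} t (λ p → fun t p * proj₁ (proj₁ p)) ≡ a
           × sumSupp {Split d} t (λ p → fun t p * proj₂ (proj₁ p)) ≡ b
           × sumSupp {Split d} t (λ p → fun t p) ≡ c )

  δ : {X : Set} → 𝒮 (𝒫 X) → 𝒫 (𝒮 X)
  δ {X} Φ φ = ⟦ Σ (𝒮 (∋ X)) (λ ψ →
      ( (∀ (A : 𝒫 X) → fun Φ A ≡ sumSupp ψ (fibre (λ p → proj₁ (proj₁ p)) (fun ψ) A))
      × (∀ (x : X) → fun φ x ≡ sumSupp ψ (fibre (λ p → proj₂ (proj₁ p)) (fun ψ) x)) )) ⟧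

  -- Weak distributive laws of 𝒫 over 𝒮 (equalities of maps into 𝒫𝒮X
  -- stated pointwise, i.e. as equalities of subsets of 𝒮X)

  record IsWeakDistributiveLaw (d : {X : Set} → 𝒮 (𝒫 X) → 𝒫 (𝒮 X)) : Set₁ where
    field
      natural : {X Y : Set} (f : X → Y) (Φ : 𝒮 (𝒫 X)) (φ : 𝒮 Y) →
        𝒫map (𝒮map f) (d Φ) φ ≡ d (𝒮map (𝒫map f) Φ) φ
      law-μ𝒫 : {X : Set} (Ψ : 𝒮 (𝒫 (𝒫 X))) (φ : 𝒮 X) →
        d (𝒮map μ𝒫 Ψ) φ ≡ μ𝒫 (𝒫map d (d Ψ)) φ
      law-μ𝒮 : {X : Set} (Ψ : 𝒮 (𝒮 (𝒫 X))) (φ : 𝒮 X) →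
        d (μ𝒮 Ψ) φ ≡ 𝒫map μ𝒮 (d (𝒮map d Ψ)) φ
      law-η𝒫 : {X : Set} (φ′ : 𝒮 X) (φ : 𝒮 X) →
        d (𝒮map η𝒫 φ′) φ ≡ η𝒫 φ′ φ

-- δ Φ φ holds exactly when Φ and φ are the two marginals of some ψ ∈ 𝒮(∋X), so each law
-- amounts to gluing such witnesses along a square of maps.  Gluing is possible because 𝒮
-- covers pullbacks: if 𝒮f α = 𝒮g β, then over each point the fibres of α and β have equal
-- totals, and positivity and refinability turn this into a transport plan whose entries lie
-- on the pullback.  The law for μ𝒮 needs moreover that the naturality square of μ𝒮 is
-- covered, i.e. that every ω with 𝒮f ω = μΨ is μΩ for some Ω over Ψ; this is where (B) and
-- (E) enter, through the n-ary form of (E) obtained by induction on the support.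

module Submission where

open import Defs
open import Level using (0ℓ)
open import Function using (_∘_)
open import Data.Bool using (true)
import Data.Bool.Properties as Bool
open import Axiom.UniquenessOfIdentityProofs using (module Decidable⇒UIP)
open import Data.Empty using (⊥-elim)
open import Data.Product using (Σ; _×_; _,_; proj₁; proj₂; ∃-syntax)
open import Data.Sum using (inj₁; inj₂)
open import Data.List using (List; []; _∷_; foldr; map; _++_; deduplicate; [_]; concatMap; filter)
open import Data.List.Membership.Propositional using (_∈_; _∉_)
open import Data.List.Membership.Propositional.Properties
  using (∈-deduplicate⁺; ∈-++⁺ˡ; ∈-++⁺ʳ; ∈-map⁺; ∈-concatMap⁺; ∈-filter⁺; ∈-filter⁻)
open import Data.List.Relation.Unary.Any using (here; there)
import Data.List.Relation.Unary.Any as Any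
open import Data.List.Relation.Unary.All using (All; []; _∷_)
import Data.List.Relation.Unary.All as All
import Data.List.Relation.Unary.All.Properties as All
open import Data.List.Relation.Unary.AllPairs using ([]; _∷_)
open import Data.List.Relation.Unary.Unique.Propositional using (Unique)
import Data.List.Relation.Unary.Unique.Propositional.Properties as Unique
open import Data.List.Relation.Unary.Unique.DecPropositional.Properties using (deduplicate-!)
open import Relation.Nullary using (¬_; Dec; yes; no)
open import Relation.Binary.PropositionalEquality hiding ([_])
open import Algebra.Core using (Op₂)
open import Algebra.Bundles using (Semiring; CommutativeMonoid)
open import Algebra.Structures using (IsSemiring)
import Algebra.Properties.CommutativeSemigroup as CommSemigroupProperties
open import Axiom.ExcludedMiddle using (ExcludedMiddle)
open import Axiom.Extensionality.Propositional using (Extensionality)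

module WeakDistributiveLaw {S : Set} {_+_ _*_ : Op₂ S} {0# 1# : S}
  (isSR : IsSemiring _≡_ _+_ _*_ 0# 1#) (lem : ExcludedMiddle 0ℓ)
  (funext : Extensionality 0ℓ 0ℓ) where

  open Semiring-Monads isSR lem
  open IsSemiring isSR using (+-assoc; +-identityˡ; +-identityʳ; distribˡ; distribʳ; zeroˡ; zeroʳ)

  semiring : Semiring 0ℓ 0ℓ
  semiring = record { isSemiring = isSR }

  open CommSemigroupProperties (CommutativeMonoid.commutativeSemigroup (Semiring.+-commutativeMonoid semiring))
    using (interchange)
  open ≡-Reasoning

  when : {P : Set} → Dec P → S → S
  when (yes _) s = s
  when (no _) s = 0#

  when-sym : {T : Set} (a b : T) (s : S) → when (a ≟ b) s ≡ when (b ≟ a) s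
  when-sym a b s with a ≟ b | b ≟ a
  ... | yes _ | yes _ = refl
  ... | no _ | no _ = refl
  ... | yes p | no q = ⊥-elim (q (sym p))
  ... | no p | yes q = ⊥-elim (p (sym q))

  when-yes : {P : Set} (d : Dec P) (s : S) → P → when d s ≡ s
  when-yes (yes _) s p = refl
  when-yes (no ¬p) s p = ⊥-elim (¬p p)

  when-no : {P : Set} (d : Dec P) (s : S) → ¬ P → when d s ≡ 0#
  when-no (yes p) s ¬p = ⊥-elim (¬p p)
  when-no (no _) s ¬p = refl

  when-0# : {P : Set} (d : Dec P) {s : S} → s ≡ 0# → when d s ≡ 0#
  when-0# (yes _) s≡0 = s≡0
  when-0# (no _) s≡0 = refl

  when-comm : {P Q : Set} (d : Dec P) (e : Dec Q) (s : S) → when d (when e s) ≡ when e (when d s)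
  when-comm (yes _) (yes _) s = refl
  when-comm (yes _) (no _) s = refl
  when-comm (no _) (yes _) s = refl
  when-comm (no _) (no _) s = refl

  when-idem : {P : Set} (d : Dec P) (s : S) → when d (when d s) ≡ when d s
  when-idem (yes _) s = refl
  when-idem (no _) s = refl

  when-+ : {P : Set} (d : Dec P) (a b : S) → when d (a + b) ≡ when d a + when d b
  when-+ (yes _) a b = refl
  when-+ (no _) a b = sym (+-identityˡ 0#)

  when-*ˡ : {P : Set} (d : Dec P) (a b : S) → when d (a * b) ≡ when d a * b
  when-*ˡ (yes _) a b = refl
  when-*ˡ (no _) a b = sym (zeroˡ b)

  when-*ʳ : {P : Set} (d : Dec P) (a b : S) → when d (a * b) ≡ a * when d b
  when-*ʳ (yes _) a b = refl
  when-*ʳ (no _) a b = sym (zeroʳ a)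

  when-× : {T U : Set} (a c : T) (b d : U) (s : S) →
    when ((a , b) ≟ (c , d)) s ≡ when (a ≟ c) (when (b ≟ d) s)
  when-× a c b d s with (a , b) ≟ (c , d) | a ≟ c | b ≟ d
  ... | yes refl | yes _ | yes _ = refl
  ... | yes refl | no a≢c | _ = ⊥-elim (a≢c refl)
  ... | yes refl | yes _ | no b≢d = ⊥-elim (b≢d refl)
  ... | no ab≢cd | yes refl | yes refl = ⊥-elim (ab≢cd refl)
  ... | no _ | no _ | _ = refl
  ... | no _ | yes _ | no _ = refl

  unless : {P : Set} → Dec P → S → S
  unless (yes _) s = 0#
  unless (no _) s = s

  unless+when : {P : Set} (d : Dec P) (s : S) → unless d s + when d s ≡ s
  unless+when (yes _) s = +-identityˡ s
  unless+when (no _) s = +-identityʳ s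

  unless-0# : {P : Set} (d : Dec P) {s : S} → s ≡ 0# → unless d s ≡ 0#
  unless-0# (yes _) s≡0 = refl
  unless-0# (no _) s≡0 = s≡0

  fibre-when : {X Y : Set} (f : X → Y) (φ : X → S) (y : Y) (x : X) →
    fibre f φ y x ≡ when (f x ≟ y) (φ x)
  fibre-when f φ y x with f x ≟ y
  ... | yes _ = refl
  ... | no _ = refl

  sumL : {T : Set} → List T → (T → S) → S
  sumL L g = foldr (λ y acc → g y + acc) 0# L

  sumL-cong : {T : Set} (L : List T) {g h : T → S} → (∀ t → t ∈ L → g t ≡ h t) → sumL L g ≡ sumL L h
  sumL-cong [] g≡h = refl
  sumL-cong (x ∷ L) g≡h = cong₂ _+_ (g≡h x (here refl)) (sumL-cong L (λ t → g≡h t ∘ there))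

  sumL-0# : {T : Set} (L : List T) {g : T → S} → (∀ t → t ∈ L → g t ≡ 0#) → sumL L g ≡ 0#
  sumL-0# [] g≡0 = refl
  sumL-0# (x ∷ L) g≡0
    rewrite g≡0 x (here refl) | sumL-0# L (λ t → g≡0 t ∘ there) = +-identityˡ 0#

  sumL-+ : {T : Set} (L : List T) (g h : T → S) → sumL L (λ t → g t + h t) ≡ sumL L g + sumL L h
  sumL-+ [] g h = sym (+-identityˡ 0#)
  sumL-+ (x ∷ L) g h rewrite sumL-+ L g h = interchange (g x) (h x) (sumL L g) (sumL L h)

  sumL-*ˡ : {T : Set} (L : List T) (c : S) (g : T → S) → sumL L (λ t → c * g t) ≡ c * sumL L g
  sumL-*ˡ [] c g = sym (zeroʳ c)
  sumL-*ˡ (x ∷ L) c g rewrite sumL-*ˡ L c g = sym (distribˡ c (g x) (sumL L g))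

  sumL-*ʳ : {T : Set} (L : List T) (c : S) (g : T → S) → sumL L (λ t → g t * c) ≡ sumL L g * c
  sumL-*ʳ [] c g = sym (zeroˡ c)
  sumL-*ʳ (x ∷ L) c g rewrite sumL-*ʳ L c g = sym (distribʳ c (g x) (sumL L g))

  sumL-when : {P T : Set} (d : Dec P) (L : List T) (h : T → S) →
    when d (sumL L h) ≡ sumL L (λ t → when d (h t))
  sumL-when (yes _) L h = refl
  sumL-when (no _) L h = sym (sumL-0# L (λ _ _ → refl))

  sumL-comm : {T U : Set} (L : List T) (K : List U) (g : T → U → S) →
    sumL L (λ t → sumL K (g t)) ≡ sumL K (λ u → sumL L (λ t → g t u))
  sumL-comm [] K g = sym (sumL-0# K (λ _ _ → refl))
  sumL-comm (x ∷ L) K g rewrite sumL-comm L K g = sym (sumL-+ K (g x) (λ u → sumL L (λ t → g t u)))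

  sumL-++ : {T : Set} (L K : List T) (g : T → S) → sumL (L ++ K) g ≡ sumL L g + sumL K g
  sumL-++ [] K g = sym (+-identityˡ _)
  sumL-++ (x ∷ L) K g rewrite sumL-++ L K g = sym (+-assoc (g x) (sumL L g) (sumL K g))

  sumL-map : {T U : Set} (f : T → U) (L : List T) (g : U → S) → sumL (map f L) g ≡ sumL L (g ∘ f)
  sumL-map f [] g = refl
  sumL-map f (x ∷ L) g = cong (g (f x) +_) (sumL-map f L g)

  sumL-concatMap : {T U : Set} (F : T → List U) (L : List T) (g : U → S) →
    sumL (concatMap F L) g ≡ sumL L (λ t → sumL (F t) g)
  sumL-concatMap F [] g = refl
  sumL-concatMap F (x ∷ L) g =
    trans (sumL-++ (F x) (concatMap F L) g) (cong (sumL (F x) g +_) (sumL-concatMap F L g))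

  sumL-proj₁ : {I B : Set} (rows : List (I × B)) (R : List I) → map proj₁ rows ≡ R → (F : I → S) →
    sumL rows (F ∘ proj₁) ≡ sumL R F
  sumL-proj₁ rows R refl F = sym (sumL-map proj₁ rows F)

  sumL-filter : {T : Set} {P : T → Set} (P? : ∀ x → Dec (P x)) (K : List T) (g : T → S) →
    sumL (filter P? K) g ≡ sumL K (λ e → when (P? e) (g e))
  sumL-filter P? [] g = refl
  sumL-filter P? (x ∷ K) g with P? x
  ... | yes _ = cong (g x +_) (sumL-filter P? K g)
  ... | no _ = trans (sumL-filter P? K g) (sym (+-identityˡ _))

  sumL-when≟-∉ : {T : Set} (K : List T) (t : T) (h : T → S) → t ∉ K →
    sumL K (λ u → when (t ≟ u) (h u)) ≡ 0#
  sumL-when≟-∉ K t h t∉K = sumL-0# K vanish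
    where
    vanish : ∀ u → u ∈ K → when (t ≟ u) (h u) ≡ 0#
    vanish u u∈K with t ≟ u
    ... | yes refl = ⊥-elim (t∉K u∈K)
    ... | no _ = refl

  sumL-when≟-∈ : {T : Set} (K : List T) → Unique K → (t : T) (h : T → S) → t ∈ K →
    sumL K (λ u → when (t ≟ u) (h u)) ≡ h t
  sumL-when≟-∈ (k ∷ K) (k∉K ∷ _) t h (here refl) with t ≟ t
  ... | yes _ = trans (cong (h t +_) (sumL-when≟-∉ K t h (All.All¬⇒¬Any k∉K))) (+-identityʳ (h t))
  ... | no t≢t = ⊥-elim (t≢t refl)
  sumL-when≟-∈ (k ∷ K) (k∉K ∷ U) t h (there t∈K) with t ≟ k
  ... | yes refl = ⊥-elim (All.All¬⇒¬Any k∉K t∈K)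
  ... | no _ = trans (+-identityˡ _) (sumL-when≟-∈ K U t h t∈K)

  SupportedIn : {T : Set} → (T → S) → List T → Set
  SupportedIn g L = ∀ t → t ∉ L → g t ≡ 0#

  sumL-supportedIn : {T : Set} (L K : List T) {g : T → S} → Unique L → Unique K →
    SupportedIn g L → SupportedIn g K → sumL L g ≡ sumL K g
  sumL-supportedIn L K {g} uL uK gL gK = begin
    sumL L g                                          ≡⟨ sumL-cong L expandK ⟩
    sumL L (λ t → sumL K (λ u → when (t ≟ u) (g u))) ≡⟨ sumL-comm L K _ ⟩
    sumL K (λ u → sumL L (λ t → when (t ≟ u) (g u))) ≡⟨ sumL-cong K contractL ⟩
    sumL K g                                          ∎
    where
    expandK : ∀ t → t ∈ L → g t ≡ sumL K (λ u → when (t ≟ u) (g u))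
    expandK t _ with lem {t ∈ K}
    ... | yes t∈K = sym (sumL-when≟-∈ K uK t g t∈K)
    ... | no t∉K = trans (gK t t∉K) (sym (sumL-when≟-∉ K t g t∉K))
    contractL : ∀ u → u ∈ K → sumL L (λ t → when (t ≟ u) (g u)) ≡ g u
    contractL u _ with lem {u ∈ L}
    ... | yes u∈L = trans (sumL-cong L (λ t _ → when-sym t u (g u))) (sumL-when≟-∈ L uL u (λ _ → g u) u∈L)
    ... | no u∉L = trans (sumL-cong L (λ t _ → when-sym t u (g u)))
                     (trans (sumL-when≟-∉ L u (λ _ → g u) u∉L) (sym (gL u u∉L)))

  dedup : {T : Set} → List T → List T
  dedup = deduplicate _≟_

  dedup-unique : {T : Set} (L : List T) → Unique (dedup L)
  dedup-unique = deduplicate-! _≟_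

  supportedIn-dedup : {T : Set} {g : T → S} (L : List T) → SupportedIn g L → SupportedIn g (dedup L)
  supportedIn-dedup L gL t t∉ = gL t (t∉ ∘ ∈-deduplicate⁺ _≟_)

  -- 0# when g is not finitely supported.
  ∑ : {T : Set} → (T → S) → S
  ∑ g with lem {Σ (List _) (SupportedIn g)}
  ... | yes (L , _) = sumL (dedup L) g
  ... | no _ = 0#

  ∑≡sumL-dedup : {T : Set} {g : T → S} (L : List T) → SupportedIn g L → ∑ g ≡ sumL (dedup L) g
  ∑≡sumL-dedup {g = g} L gL with lem {Σ (List _) (SupportedIn g)}
  ... | yes (L′ , gL′) = sumL-supportedIn (dedup L′) (dedup L) (dedup-unique L′) (dedup-unique L)
                           (supportedIn-dedup L′ gL′) (supportedIn-dedup L gL)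
  ... | no ∄L = ⊥-elim (∄L (L , gL))

  ∑≡sumL : {T : Set} {g : T → S} (L : List T) → Unique L → SupportedIn g L → ∑ g ≡ sumL L g
  ∑≡sumL L uL gL = trans (∑≡sumL-dedup L gL)
    (sumL-supportedIn _ L (dedup-unique L) uL (supportedIn-dedup L gL) gL)

  ∑-cong : {T : Set} {g h : T → S} → (∀ t → g t ≡ h t) → ∑ g ≡ ∑ h
  ∑-cong g≗h = cong ∑ (funext g≗h)

  ∑-0# : {T : Set} {g : T → S} → (∀ t → g t ≡ 0#) → ∑ g ≡ 0#
  ∑-0# g≡0 = ∑≡sumL-dedup [] (λ t _ → g≡0 t)

  ∑-*ˡ : {T : Set} {g : T → S} (L : List T) → SupportedIn g L → (c : S) → ∑ (λ t → c * g t) ≡ c * ∑ g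
  ∑-*ˡ {g = g} L gL c = begin
    ∑ (λ t → c * g t)           ≡⟨ ∑≡sumL-dedup L (λ t t∉ → trans (cong (c *_) (gL t t∉)) (zeroʳ c)) ⟩
    sumL (dedup L) (λ t → c * g t) ≡⟨ sumL-*ˡ (dedup L) c g ⟩
    c * sumL (dedup L) g           ≡⟨ cong (c *_) (sym (∑≡sumL-dedup L gL)) ⟩
    c * ∑ g                        ∎

  ∑-*ʳ : {T : Set} {g : T → S} (L : List T) → SupportedIn g L → (c : S) → ∑ (λ t → g t * c) ≡ ∑ g * c
  ∑-*ʳ {g = g} L gL c = begin
    ∑ (λ t → g t * c)              ≡⟨ ∑≡sumL-dedup L (λ t t∉ → trans (cong (_* c) (gL t t∉)) (zeroˡ c)) ⟩
    sumL (dedup L) (λ t → g t * c) ≡⟨ sumL-*ʳ (dedup L) c g ⟩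
    sumL (dedup L) g * c           ≡⟨ cong (_* c) (sym (∑≡sumL-dedup L gL)) ⟩
    ∑ g * c                        ∎

  ∑-when : {P T : Set} (d : Dec P) (h : T → S) → when d (∑ h) ≡ ∑ (λ t → when d (h t))
  ∑-when (yes _) h = refl
  ∑-when (no _) h = sym (∑-0# (λ _ → refl))

  ∑-comm : {T U : Set} (g : T → U → S) (L : List T) (K : List U) →
    (∀ t u → t ∉ L → g t u ≡ 0#) → (∀ t u → u ∉ K → g t u ≡ 0#) →
    ∑ (λ t → ∑ (g t)) ≡ ∑ (λ u → ∑ (λ t → g t u))
  ∑-comm g L K gL gK = begin
    ∑ (λ t → ∑ (g t))
      ≡⟨ ∑-cong (λ t → ∑≡sumL-dedup K (gK t)) ⟩
    ∑ (λ t → sumL (dedup K) (g t))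
      ≡⟨ ∑≡sumL-dedup L (λ t t∉ → sumL-0# (dedup K) (λ u _ → gL t u t∉)) ⟩
    sumL (dedup L) (λ t → sumL (dedup K) (g t))
      ≡⟨ sumL-comm (dedup L) (dedup K) g ⟩
    sumL (dedup K) (λ u → sumL (dedup L) (λ t → g t u))
      ≡⟨ sym (∑≡sumL-dedup K (λ u u∉ → sumL-0# (dedup L) (λ t _ → gK t u u∉))) ⟩
    ∑ (λ u → sumL (dedup L) (λ t → g t u))
      ≡⟨ sym (∑-cong (λ u → ∑≡sumL-dedup L (λ t t∉ → gL t u t∉))) ⟩
    ∑ (λ u → ∑ (λ t → g t u)) ∎

  ∑-sumL-comm : {T U : Set} (L : List T) (g : T → U → S) (K : List U) →
    (∀ t u → t ∈ L → u ∉ K → g t u ≡ 0#) →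
    ∑ (λ u → sumL L (λ t → g t u)) ≡ sumL L (λ t → ∑ (g t))
  ∑-sumL-comm L g K gK = begin
    ∑ (λ u → sumL L (λ t → g t u))
      ≡⟨ ∑≡sumL-dedup K (λ u u∉ → sumL-0# L (λ t t∈ → gK t u t∈ u∉)) ⟩
    sumL (dedup K) (λ u → sumL L (λ t → g t u))
      ≡⟨ sym (sumL-comm L (dedup K) g) ⟩
    sumL L (λ t → sumL (dedup K) (g t))
      ≡⟨ sym (sumL-cong L (λ t t∈ → ∑≡sumL-dedup K (λ u → gK t u t∈))) ⟩
    sumL L (λ t → ∑ (g t)) ∎

  ∑-when≟ : {T : Set} (t : T) (h : T → S) → ∑ (λ u → when (t ≟ u) (h u)) ≡ h t
  ∑-when≟ t h = trans (∑≡sumL [ t ] ([] ∷ []) vanish) (sumL-when≟-∈ [ t ] ([] ∷ []) t h (here refl))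
    where
    vanish : SupportedIn (λ u → when (t ≟ u) (h u)) [ t ]
    vanish u u∉ with t ≟ u
    ... | yes refl = ⊥-elim (u∉ (here refl))
    ... | no _ = refl

  ∑-when≟ʳ : {T : Set} (t : T) (h : T → S) → ∑ (λ u → when (u ≟ t) (h u)) ≡ h t
  ∑-when≟ʳ t h = trans (∑-cong (λ u → when-sym u t (h u))) (∑-when≟ t h)

  ∑-when-proj₁≟ : {T U : Set} (t₀ : T) (H : T × U → S) (K : List U) →
    (∀ u → u ∉ K → H (t₀ , u) ≡ 0#) →
    ∑ (λ tu → when (proj₁ tu ≟ t₀) (H tu)) ≡ ∑ (λ u → H (t₀ , u))
  ∑-when-proj₁≟ t₀ H K HK = begin
    ∑ (λ tu → when (proj₁ tu ≟ t₀) (H tu))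
      ≡⟨ ∑≡sumL (map (t₀ ,_) (dedup K)) (Unique.map⁺ (λ { refl → refl }) (dedup-unique K)) vanish ⟩
    sumL (map (t₀ ,_) (dedup K)) (λ tu → when (proj₁ tu ≟ t₀) (H tu))
      ≡⟨ sumL-map _ (dedup K) _ ⟩
    sumL (dedup K) (λ u → when (t₀ ≟ t₀) (H (t₀ , u)))
      ≡⟨ sumL-cong (dedup K) (λ u _ → when-yes (t₀ ≟ t₀) _ refl) ⟩
    sumL (dedup K) (λ u → H (t₀ , u))
      ≡⟨ sym (∑≡sumL-dedup K HK) ⟩
    ∑ (λ u → H (t₀ , u)) ∎
    where
    vanish : SupportedIn (λ tu → when (proj₁ tu ≟ t₀) (H tu)) (map (t₀ ,_) (dedup K))
    vanish (t , u) tu∉ with t ≟ t₀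
    ... | no _ = refl
    ... | yes refl = supportedIn-dedup K HK u (tu∉ ∘ ∈-map⁺ (t₀ ,_))

  ∑-when-proj₂≟ : {T U : Set} (u₀ : U) (H : T × U → S) (K : List T) →
    (∀ t → t ∉ K → H (t , u₀) ≡ 0#) →
    ∑ (λ tu → when (proj₂ tu ≟ u₀) (H tu)) ≡ ∑ (λ t → H (t , u₀))
  ∑-when-proj₂≟ u₀ H K HK = begin
    ∑ (λ tu → when (proj₂ tu ≟ u₀) (H tu))
      ≡⟨ ∑≡sumL (map (_, u₀) (dedup K)) (Unique.map⁺ (λ { refl → refl }) (dedup-unique K)) vanish ⟩
    sumL (map (_, u₀) (dedup K)) (λ tu → when (proj₂ tu ≟ u₀) (H tu))
      ≡⟨ sumL-map _ (dedup K) _ ⟩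
    sumL (dedup K) (λ t → when (u₀ ≟ u₀) (H (t , u₀)))
      ≡⟨ sumL-cong (dedup K) (λ t _ → when-yes (u₀ ≟ u₀) _ refl) ⟩
    sumL (dedup K) (λ t → H (t , u₀))
      ≡⟨ sym (∑≡sumL-dedup K HK) ⟩
    ∑ (λ t → H (t , u₀)) ∎
    where
    vanish : SupportedIn (λ tu → when (proj₂ tu ≟ u₀) (H tu)) (map (_, u₀) (dedup K))
    vanish (t , u) tu∉ with u ≟ u₀
    ... | no _ = refl
    ... | yes refl = supportedIn-dedup K HK t (tu∉ ∘ ∈-map⁺ (_, u₀))

  𝒮-ext : {X : Set} (φ ψ : 𝒮 X) → (∀ x → fun φ x ≡ fun ψ x) → φ ≡ ψ
  𝒮-ext (mk𝒮 f p) (mk𝒮 g q) f≗g with funext f≗g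
  ... | refl = cong (mk𝒮 f) (funext (λ k → ⊥-elim (p k)))

  sumSupp≡∑ : {X : Set} (φ : 𝒮 X) (g : X → S) → SupportedIn g (suppList φ) → sumSupp φ g ≡ ∑ g
  sumSupp≡∑ φ g gφ = sym (∑≡sumL-dedup (suppList φ) gφ)

  𝒮map-apply : {X Y : Set} (f : X → Y) (φ : 𝒮 X) (y : Y) →
    fun (𝒮map f φ) y ≡ ∑ (λ x → when (f x ≟ y) (fun φ x))
  𝒮map-apply f φ y = trans (sumSupp≡∑ φ _ vanish) (∑-cong (fibre-when f (fun φ) y))
    where
    vanish : SupportedIn (fibre f (fun φ) y) (suppList φ)
    vanish x x∉ = trans (fibre-when f (fun φ) y x) (when-0# (f x ≟ y) (suppList-ok φ x x∉))

  μ𝒮-apply : {X : Set} (Ψ : 𝒮 (𝒮 X)) (x : X) → fun (μ𝒮 Ψ) x ≡ ∑ (λ φ → fun Ψ φ * fun φ x)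
  μ𝒮-apply Ψ x = sumSupp≡∑ Ψ _ (λ φ φ∉ → trans (cong (_* fun φ x) (suppList-ok Ψ φ φ∉)) (zeroˡ _))

  𝒮map-cong : {X Y : Set} {f g : X → Y} (φ : 𝒮 X) → (∀ x → f x ≡ g x) → 𝒮map f φ ≡ 𝒮map g φ
  𝒮map-cong φ f≗g = cong (λ h → 𝒮map h φ) (funext f≗g)

  𝒮map-id : {X : Set} (φ : 𝒮 X) → 𝒮map (λ x → x) φ ≡ φ
  𝒮map-id φ = 𝒮-ext _ _ (λ y → trans (𝒮map-apply (λ x → x) φ y) (∑-when≟ʳ y (fun φ)))

  𝒮map-∘ : {X Y Z : Set} (f : X → Y) (g : Y → Z) (φ : 𝒮 X) → 𝒮map g (𝒮map f φ) ≡ 𝒮map (g ∘ f) φ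
  𝒮map-∘ f g φ = 𝒮-ext _ _ λ z → begin
    fun (𝒮map g (𝒮map f φ)) z
      ≡⟨ 𝒮map-apply g _ z ⟩
    ∑ (λ y → when (g y ≟ z) (fun (𝒮map f φ) y))
      ≡⟨ ∑-cong (λ y → trans (cong (when (g y ≟ z)) (𝒮map-apply f φ y)) (∑-when (g y ≟ z) _)) ⟩
    ∑ (λ y → ∑ (λ x → when (g y ≟ z) (when (f x ≟ y) (fun φ x))))
      ≡⟨ ∑-comm _ (map f (suppList φ)) (suppList φ) (vanish-y z) (vanish-x z) ⟩
    ∑ (λ x → ∑ (λ y → when (g y ≟ z) (when (f x ≟ y) (fun φ x))))
      ≡⟨ ∑-cong (λ x → trans (∑-cong (λ y → when-comm (g y ≟ z) (f x ≟ y) (fun φ x)))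
                              (∑-when≟ (f x) (λ y → when (g y ≟ z) (fun φ x)))) ⟩
    ∑ (λ x → when (g (f x) ≟ z) (fun φ x))
      ≡⟨ sym (𝒮map-apply (g ∘ f) φ z) ⟩
    fun (𝒮map (g ∘ f) φ) z ∎
    where
    vanish-y : ∀ z y x → y ∉ map f (suppList φ) → when (g y ≟ z) (when (f x ≟ y) (fun φ x)) ≡ 0#
    vanish-y z y x y∉ with f x ≟ y | lem {x ∈ suppList φ}
    ... | yes refl | yes x∈ = ⊥-elim (y∉ (∈-map⁺ f x∈))
    ... | yes refl | no x∉ = when-0# (g (f x) ≟ z) (suppList-ok φ x x∉)
    ... | no _ | _ = when-0# (g y ≟ z) refl
    vanish-x : ∀ z y x → x ∉ suppList φ → when (g y ≟ z) (when (f x ≟ y) (fun φ x)) ≡ 0#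
    vanish-x z y x x∉ = when-0# (g y ≟ z) (when-0# (f x ≟ y) (suppList-ok φ x x∉))

  𝒮map-∘≗ : {X Y Z : Set} (f : X → Y) (g : Y → Z) (h : X → Z) (φ : 𝒮 X) → (∀ x → g (f x) ≡ h x) →
    𝒮map g (𝒮map f φ) ≡ 𝒮map h φ
  𝒮map-∘≗ f g h φ g∘f≗h = trans (𝒮map-∘ f g φ) (𝒮map-cong φ g∘f≗h)

  𝒮map-square : {X Y Y′ Z : Set} (f : X → Y) (g : Y → Z) (h : X → Y′) (k : Y′ → Z) (φ : 𝒮 X) →
    (∀ x → g (f x) ≡ k (h x)) → 𝒮map g (𝒮map f φ) ≡ 𝒮map k (𝒮map h φ)
  𝒮map-square f g h k φ square = trans (𝒮map-∘≗ f g (k ∘ h) φ square) (sym (𝒮map-∘ h k φ))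

  ∑-𝒮map : {X Y : Set} (f : X → Y) (φ : 𝒮 X) (g : Y → S) →
    ∑ (λ y → fun (𝒮map f φ) y * g y) ≡ ∑ (λ x → fun φ x * g (f x))
  ∑-𝒮map f φ g = begin
    ∑ (λ y → fun (𝒮map f φ) y * g y)
      ≡⟨ ∑-cong (λ y → trans (cong (_* g y) (𝒮map-apply f φ y))
                              (sym (∑-*ʳ (suppList φ) (λ x x∉ → when-0# (f x ≟ y) (suppList-ok φ x x∉)) (g y)))) ⟩
    ∑ (λ y → ∑ (λ x → when (f x ≟ y) (fun φ x) * g y))
      ≡⟨ ∑-comm _ (map f (suppList φ)) (suppList φ) vanish-y vanish-x ⟩
    ∑ (λ x → ∑ (λ y → when (f x ≟ y) (fun φ x) * g y))
      ≡⟨ ∑-cong (λ x → trans (∑-cong (λ y → sym (when-*ˡ (f x ≟ y) (fun φ x) (g y))))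
                              (∑-when≟ (f x) (λ y → fun φ x * g y))) ⟩
    ∑ (λ x → fun φ x * g (f x)) ∎
    where
    vanish-y : ∀ y x → y ∉ map f (suppList φ) → when (f x ≟ y) (fun φ x) * g y ≡ 0#
    vanish-y y x y∉ with f x ≟ y | lem {x ∈ suppList φ}
    ... | yes refl | yes x∈ = ⊥-elim (y∉ (∈-map⁺ f x∈))
    ... | yes refl | no x∉ = trans (cong (_* g y) (suppList-ok φ x x∉)) (zeroˡ _)
    ... | no _ | _ = zeroˡ _
    vanish-x : ∀ y x → x ∉ suppList φ → when (f x ≟ y) (fun φ x) * g y ≡ 0#
    vanish-x y x x∉ = trans (cong (_* g y) (when-0# (f x ≟ y) (suppList-ok φ x x∉))) (zeroˡ _)

  μ𝒮-natural : {X Y : Set} (f : X → Y) (Ψ : 𝒮 (𝒮 X)) → 𝒮map f (μ𝒮 Ψ) ≡ μ𝒮 (𝒮map (𝒮map f) Ψ)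
  μ𝒮-natural f Ψ = 𝒮-ext _ _ pointwise
    where
    pointwise : ∀ y → fun (𝒮map f (μ𝒮 Ψ)) y ≡ fun (μ𝒮 (𝒮map (𝒮map f) Ψ)) y
    pointwise y = begin
      fun (𝒮map f (μ𝒮 Ψ)) y
        ≡⟨ 𝒮map-apply f _ y ⟩
      ∑ (λ x → when (f x ≟ y) (fun (μ𝒮 Ψ) x))
        ≡⟨ ∑-cong (λ x → trans (cong (when (f x ≟ y)) (μ𝒮-apply Ψ x)) (∑-when (f x ≟ y) _)) ⟩
      ∑ (λ x → ∑ (λ φ → when (f x ≟ y) (fun Ψ φ * fun φ x)))
        ≡⟨ ∑-comm _ (concatMap suppList (suppList Ψ)) (suppList Ψ) vanish-x vanish-φ ⟩
      ∑ (λ φ → ∑ (λ x → when (f x ≟ y) (fun Ψ φ * fun φ x)))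
        ≡⟨ ∑-cong (λ φ → trans (∑-cong (λ x → when-*ʳ (f x ≟ y) (fun Ψ φ) (fun φ x)))
                 (trans (∑-*ˡ (suppList φ) (λ x x∉ → when-0# (f x ≟ y) (suppList-ok φ x x∉)) (fun Ψ φ))
                        (cong (fun Ψ φ *_) (sym (𝒮map-apply f φ y))))) ⟩
      ∑ (λ φ → fun Ψ φ * fun (𝒮map f φ) y)
        ≡⟨ sym (∑-𝒮map (𝒮map f) Ψ (λ χ → fun χ y)) ⟩
      ∑ (λ χ → fun (𝒮map (𝒮map f) Ψ) χ * fun χ y)
        ≡⟨ sym (μ𝒮-apply _ y) ⟩
      fun (μ𝒮 (𝒮map (𝒮map f) Ψ)) y ∎
      where
      vanish-φ : ∀ x φ → φ ∉ suppList Ψ → when (f x ≟ y) (fun Ψ φ * fun φ x) ≡ 0#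
      vanish-φ x φ φ∉ = when-0# (f x ≟ y) (trans (cong (_* fun φ x) (suppList-ok Ψ φ φ∉)) (zeroˡ _))
      vanish-x : ∀ x φ → x ∉ concatMap suppList (suppList Ψ) → when (f x ≟ y) (fun Ψ φ * fun φ x) ≡ 0#
      vanish-x x φ x∉ with lem {φ ∈ suppList Ψ}
      ... | no φ∉ = vanish-φ x φ φ∉
      ... | yes φ∈ with lem {x ∈ suppList φ}
      ...   | yes x∈ = ⊥-elim (x∉ (∈-concatMap⁺ suppList (Any.map (λ { refl → x∈ }) φ∈)))
      ...   | no x∉φ = when-0# (f x ≟ y) (trans (cong (fun Ψ φ *_) (suppList-ok φ x x∉φ)) (zeroʳ _))

  weight : {T : Set} → List (S × T) → T → S
  weight l t = sumL l (λ p → when (proj₂ p ≟ t) (proj₁ p))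

  weight-supportedIn : {T : Set} (l : List (S × T)) → SupportedIn (weight l) (map proj₂ l)
  weight-supportedIn l t t∉ = sumL-0# l vanish
    where
    vanish : ∀ p → p ∈ l → when (proj₂ p ≟ t) (proj₁ p) ≡ 0#
    vanish p p∈ with proj₂ p ≟ t
    ... | yes refl = ⊥-elim (t∉ (∈-map⁺ proj₂ p∈))
    ... | no _ = refl

  formalSum : {T : Set} → List (S × T) → 𝒮 T
  formalSum l = mk𝒮 (weight l) (λ k → k (map proj₂ l , weight-supportedIn l))

  ∑-formalSum : {T : Set} (l : List (S × T)) (g : T → S) →
    ∑ (λ t → weight l t * g t) ≡ sumL l (λ p → proj₁ p * g (proj₂ p))
  ∑-formalSum l g = begin
    ∑ (λ t → weight l t * g t)
      ≡⟨ ∑-cong (λ t → sym (sumL-*ʳ l (g t) _)) ⟩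
    ∑ (λ t → sumL l (λ p → when (proj₂ p ≟ t) (proj₁ p) * g t))
      ≡⟨ ∑-sumL-comm l _ (map proj₂ l) vanish ⟩
    sumL l (λ p → ∑ (λ t → when (proj₂ p ≟ t) (proj₁ p) * g t))
      ≡⟨ sumL-cong l (λ p _ → trans (∑-cong (λ t → sym (when-*ˡ (proj₂ p ≟ t) _ _)))
                                     (∑-when≟ (proj₂ p) (λ t → proj₁ p * g t))) ⟩
    sumL l (λ p → proj₁ p * g (proj₂ p)) ∎
    where
    vanish : ∀ p t → p ∈ l → t ∉ map proj₂ l → when (proj₂ p ≟ t) (proj₁ p) * g t ≡ 0#
    vanish p t p∈ t∉ with proj₂ p ≟ t
    ... | yes refl = ⊥-elim (t∉ (∈-map⁺ proj₂ p∈))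
    ... | no _ = zeroˡ _

  μ𝒮-formalSum : {T : Set} (l : List (S × 𝒮 T)) (x : T) →
    fun (μ𝒮 (formalSum l)) x ≡ sumL l (λ p → proj₁ p * fun (proj₂ p) x)
  μ𝒮-formalSum l x = trans (μ𝒮-apply (formalSum l) x) (∑-formalSum l (λ φ → fun φ x))

  𝒮map-formalSum-apply : {T U : Set} (h : T → U) (l : List (S × T)) (u : U) →
    fun (𝒮map h (formalSum l)) u ≡ sumL l (λ p → when (h (proj₂ p) ≟ u) (proj₁ p))
  𝒮map-formalSum-apply h l u = begin
    fun (𝒮map h (formalSum l)) u
      ≡⟨ 𝒮map-apply h _ u ⟩
    ∑ (λ x → when (h x ≟ u) (weight l x))
      ≡⟨ ∑-cong (λ x → sumL-when (h x ≟ u) l _) ⟩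
    ∑ (λ x → sumL l (λ p → when (h x ≟ u) (when (proj₂ p ≟ x) (proj₁ p))))
      ≡⟨ ∑-sumL-comm l _ (map proj₂ l) vanish ⟩
    sumL l (λ p → ∑ (λ x → when (h x ≟ u) (when (proj₂ p ≟ x) (proj₁ p))))
      ≡⟨ sumL-cong l (λ p _ → trans (∑-cong (λ x → when-comm (h x ≟ u) (proj₂ p ≟ x) _))
                                     (∑-when≟ (proj₂ p) (λ x → when (h x ≟ u) (proj₁ p)))) ⟩
    sumL l (λ p → when (h (proj₂ p) ≟ u) (proj₁ p)) ∎
    where
    vanish : ∀ p x → p ∈ l → x ∉ map proj₂ l → when (h x ≟ u) (when (proj₂ p ≟ x) (proj₁ p)) ≡ 0#
    vanish p x p∈ x∉ with proj₂ p ≟ x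
    ... | yes refl = ⊥-elim (x∉ (∈-map⁺ proj₂ p∈))
    ... | no _ = when-0# (h x ≟ u) refl

  _[_≔_] : {T : Set} → (T → S) → T → S → T → S
  (g [ k ≔ a ]) e with e ≟ k
  ... | yes _ = a
  ... | no _ = g e

  ≔-same : {T : Set} (g : T → S) (k : T) (a : S) → (g [ k ≔ a ]) k ≡ a
  ≔-same g k a with k ≟ k
  ... | yes _ = refl
  ... | no k≢k = ⊥-elim (k≢k refl)

  ≔-other : {T : Set} (g : T → S) (k : T) (a : S) (e : T) → ¬ e ≡ k → (g [ k ≔ a ]) e ≡ g e
  ≔-other g k a e e≢k with e ≟ k
  ... | yes e≡k = ⊥-elim (e≢k e≡k)
  ... | no _ = refl

  sumL-≔-∉ : {T : Set} (L : List T) (g : T → S) (k : T) (a : S) → k ∉ L → sumL L (g [ k ≔ a ]) ≡ sumL L g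
  sumL-≔-∉ L g k a k∉ = sumL-cong L (λ e e∈ → ≔-other g k a e (λ { refl → k∉ e∈ }))

  sumL-≔-∷ : {T : Set} (K : List T) (g : T → S) (k : T) (a : S) → k ∉ K →
    sumL (k ∷ K) (g [ k ≔ a ]) ≡ a + sumL K g
  sumL-≔-∷ K g k a k∉ = cong₂ _+_ (≔-same g k a) (sumL-≔-∉ K g k a k∉)

  supportedIn-≔ : {T : Set} (g : T → S) (k : T) (a : S) (K : List T) →
    SupportedIn g K → SupportedIn (g [ k ≔ a ]) (k ∷ K)
  supportedIn-≔ g k a K gK e e∉ = trans (≔-other g k a e (λ { refl → e∉ (here refl) })) (gK e (e∉ ∘ there))

  supportedIn-≔0# : {T : Set} (g : T → S) (k : T) (K : List T) →
    SupportedIn g (k ∷ K) → SupportedIn (g [ k ≔ 0# ]) K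
  supportedIn-≔0# g k K gK e e∉ with e ≟ k
  ... | yes _ = refl
  ... | no e≢k = gK e (λ { (here e≡k) → e≢k e≡k ; (there e∈) → e∉ e∈ })

  HasTotal : {E : Set} → List E → S → (E → S) → Set
  HasTotal K d g = SupportedIn g K × sumL K g ≡ d

  Mixture : {E : Set} → ((E → S) → Set) → S → (E → S) → Set
  Mixture {E} Good c v = Σ (List (S × (E → S))) λ l →
    sumL l proj₁ ≡ c × All (Good ∘ proj₂) l × (∀ e → sumL l (λ p → proj₁ p * proj₂ p e) ≡ v e)

  mixture-cong : {E : Set} {Good : (E → S) → Set} {c c′ : S} {v v′ : E → S} →
    c ≡ c′ → (∀ e → v e ≡ v′ e) → Mixture Good c v → Mixture Good c′ v′
  mixture-cong c≡c′ v≗v′ (l , Σt , good , Σtw) =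
    l , trans Σt c≡c′ , good , (λ e → trans (Σtw e) (v≗v′ e))

  mixture-shift : {E : Set} {Good Good′ : (E → S) → Set} {c : S} {v : E → S} (w : E → S) →
    (∀ y → Good y → Good′ (λ e → w e + y e)) → Mixture Good c v → Mixture Good′ c (λ e → (c * w e) + v e)
  mixture-shift {c = c} {v} w shift (l , Σt , good , Σtw) =
    map (λ p → proj₁ p , (λ e → w e + proj₂ p e)) l ,
    trans (sumL-map _ l proj₁) Σt ,
    All.gmap⁺ (λ {p} → shift (proj₂ p)) good ,
    λ e → begin
      sumL (map _ l) (λ p → proj₁ p * proj₂ p e)
        ≡⟨ sumL-map _ l _ ⟩
      sumL l (λ p → proj₁ p * (w e + proj₂ p e))
        ≡⟨ sumL-cong l (λ p _ → distribˡ (proj₁ p) (w e) (proj₂ p e)) ⟩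
      sumL l (λ p → (proj₁ p * w e) + (proj₁ p * proj₂ p e))
        ≡⟨ sumL-+ l _ _ ⟩
      sumL l (λ p → proj₁ p * w e) + sumL l (λ p → proj₁ p * proj₂ p e)
        ≡⟨ cong₂ _+_ (trans (sumL-*ʳ l (w e) proj₁) (cong (_* w e) Σt)) (Σtw e) ⟩
      (c * w e) + v e ∎

  mixture-concat : {I E : Set} {Good : (E → S) → Set} (xs : List I) (c : I → S) (v : I → E → S) →
    (∀ i → i ∈ xs → Mixture Good (c i) (v i)) → Mixture Good (sumL xs c) (λ e → sumL xs (λ i → v i e))
  mixture-concat [] c v mix = [] , refl , [] , (λ _ → refl)
  mixture-concat (i ∷ xs) c v mix =
    let (l , Σt , good , Σtw) = mix i (here refl)
        (l′ , Σt′ , good′ , Σtw′) = mixture-concat xs c v (λ j → mix j ∘ there)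
    in l ++ l′ , trans (sumL-++ l l′ proj₁) (cong₂ _+_ Σt Σt′) , All.++⁺ good good′ ,
       (λ e → trans (sumL-++ l l′ _) (cong₂ _+_ (Σtw e) (Σtw′ e)))

  TransportPlan : {I E : Set} → List I → (I → S) → List E → (E → S) → Set
  TransportPlan {I} {E} R w K v = Σ (List (I × (E → S))) λ rows →
    map proj₁ rows ≡ R × All (λ row → HasTotal K (w (proj₁ row)) (proj₂ row)) rows ×
    (∀ e → sumL rows (λ row → proj₂ row e) ≡ v e)

  mixture-glue : {I E : Set} {Good : (E → S) → Set} (R : List I) (c d : I → S) (w : I → E → S)
    (K : List E) (v : E → S) →
    (∀ c′ d′ s → SupportedIn s K → sumL K s ≡ c′ * d′ → Mixture (HasTotal K d′) c′ s) →
    (∀ i → i ∈ R → ∀ y → HasTotal K (d i) y → Good (λ e → w i e + y e)) →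
    TransportPlan R (λ i → c i * d i) K v →
    Mixture Good (sumL R c) (λ e → sumL R (λ i → c i * w i e) + v e)
  mixture-glue {I} {E} {Good} R c d w K v mix extend (rows , rows-R , rows-ok , columns) =
    mixture-cong (sumL-proj₁ rows R rows-R c) pointwise (mixture-concat rows (c ∘ proj₁) shifted part)
    where
    shifted : I × (E → S) → E → S
    shifted (i , s) e = (c i * w i e) + s e
    part : ∀ row → row ∈ rows → Mixture Good (c (proj₁ row)) (shifted row)
    part (i , s) row∈ =
      mixture-shift (w i) (extend i (subst (i ∈_) rows-R (∈-map⁺ proj₁ row∈)))
        (mix (c i) (d i) s (proj₁ (All.lookup rows-ok row∈)) (proj₂ (All.lookup rows-ok row∈)))
    pointwise : ∀ e → sumL rows (λ row → shifted row e) ≡ sumL R (λ i → c i * w i e) + v e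
    pointwise e = trans (sumL-+ rows _ _) (cong₂ _+_ (sumL-proj₁ rows R rows-R (λ i → c i * w i e)) (columns e))

  FibreTotals : {E B : Set} → (E → B) → List E → (B → S) → (E → S) → Set
  FibreTotals f Ke Φ w = SupportedIn w Ke × (∀ b → sumL Ke (λ e → when (f e ≟ b) (w e)) ≡ Φ b)

  module FibreStep {E B : Set} (f : E → B) (b : B) (Ke : List E) (uKe : Unique Ke) where

    Kb : List E
    Kb = filter (λ e → f e ≟ b) Ke

    Kb-unique : Unique Kb
    Kb-unique = Unique.filter⁺ (λ e → f e ≟ b) uKe

    onFibre : (E → S) → E → S
    onFibre v e = when (f e ≟ b) (v e)

    offFibre : (E → S) → E → S
    offFibre v e = unless (f e ≟ b) (v e)

    onFibre-supportedIn : (v : E → S) → SupportedIn v Ke → SupportedIn (onFibre v) Kb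
    onFibre-supportedIn v vKe e e∉ with f e ≟ b
    ... | no _ = refl
    ... | yes fe≡b = vKe e (λ e∈ → e∉ (∈-filter⁺ (λ e → f e ≟ b) e∈ fe≡b))

    supportedIn-Kb⇒onFibre : (y : E → S) → SupportedIn y Kb → ∀ e → y e ≡ onFibre y e
    supportedIn-Kb⇒onFibre y yKb e with lem {e ∈ Kb}
    ... | yes e∈ = sym (when-yes (f e ≟ b) (y e) (proj₂ (∈-filter⁻ (λ e → f e ≟ b) {xs = Ke} e∈)))
    ... | no e∉ = trans (yKb e e∉) (sym (when-0# (f e ≟ b) (yKb e e∉)))

    fibreTotals-shift : (Φ : B → S) (w y : E → S) → FibreTotals f Ke (Φ [ b ≔ 0# ]) w →
      HasTotal Kb (Φ b) y → FibreTotals f Ke Φ (λ e → w e + y e)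
    fibreTotals-shift Φ w y (wKe , Σw) (yKb , Σy) =
      (λ e e∉ → trans (cong₂ _+_ (wKe e e∉) (yKb e (e∉ ∘ proj₁ ∘ ∈-filter⁻ (λ e → f e ≟ b) {xs = Ke})))
                      (+-identityˡ 0#)) ,
      (λ b′ → begin
        sumL Ke (λ e → when (f e ≟ b′) (w e + y e))
          ≡⟨ sumL-cong Ke (λ e _ → when-+ (f e ≟ b′) (w e) (y e)) ⟩
        sumL Ke (λ e → when (f e ≟ b′) (w e) + when (f e ≟ b′) (y e))
          ≡⟨ sumL-+ Ke _ _ ⟩
        sumL Ke (λ e → when (f e ≟ b′) (w e)) + sumL Ke (λ e → when (f e ≟ b′) (y e))
          ≡⟨ cong (_+ _) (Σw b′) ⟩
        (Φ [ b ≔ 0# ]) b′ + sumL Ke (λ e → when (f e ≟ b′) (y e))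
          ≡⟨ y-fibre b′ (b′ ≟ b) ⟩
        Φ b′ ∎)
      where
      y-fibre : ∀ b′ → Dec (b′ ≡ b) →
        (Φ [ b ≔ 0# ]) b′ + sumL Ke (λ e → when (f e ≟ b′) (y e)) ≡ Φ b′
      y-fibre b′ (yes refl) =
        trans (cong₂ _+_ (≔-same Φ b 0#) (trans (sym (sumL-filter (λ e → f e ≟ b) Ke y)) Σy)) (+-identityˡ _)
      y-fibre b′ (no b′≢b) =
        trans (cong₂ _+_ (≔-other Φ b 0# b′ b′≢b) (sumL-0# Ke vanish)) (+-identityʳ _)
        where
        vanish : ∀ e → e ∈ Ke → when (f e ≟ b′) (y e) ≡ 0#
        vanish e _ with f e ≟ b′
        ... | no _ = refl
        ... | yes refl = trans (supportedIn-Kb⇒onFibre y yKb e) (when-no (f e ≟ b) (y e) b′≢b)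

    offFibre-sums : (c : S) (Φ : B → S) (v : E → S) →
      (∀ b′ → sumL Ke (λ e → when (f e ≟ b′) (v e)) ≡ c * Φ b′) →
      ∀ b′ → sumL Ke (λ e → when (f e ≟ b′) (offFibre v e)) ≡ c * (Φ [ b ≔ 0# ]) b′
    offFibre-sums c Φ v Σv b′ with b′ ≟ b
    ... | yes refl = trans (sumL-0# Ke (λ e _ → cancel (f e ≟ b′))) (sym (zeroʳ c))
      where
      cancel : ∀ {e} (d : Dec (f e ≡ b′)) → when d (unless d (v e)) ≡ 0#
      cancel (yes _) = refl
      cancel (no _) = refl
    ... | no b′≢b = trans (sumL-cong Ke (λ e _ → same e)) (Σv b′)
      where
      same : ∀ e → when (f e ≟ b′) (offFibre v e) ≡ when (f e ≟ b′) (v e)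
      same e with f e ≟ b′
      ... | no _ = refl
      ... | yes refl with f e ≟ b
      ...   | yes fe≡b = ⊥-elim (b′≢b fe≡b)
      ...   | no _ = refl

    onFibre-sum : (c : S) (Φ : B → S) (v : E → S) → sumL Ke (onFibre v) ≡ c * Φ b →
      sumL Kb (onFibre v) ≡ c * Φ b
    onFibre-sum c Φ v Σv = begin
      sumL Kb (onFibre v)                 ≡⟨ sumL-filter (λ e → f e ≟ b) Ke (onFibre v) ⟩
      sumL Ke (onFibre (onFibre v))       ≡⟨ sumL-cong Ke (λ e _ → when-idem (f e ≟ b) (v e)) ⟩
      sumL Ke (onFibre v)                 ≡⟨ Σv ⟩
      c * Φ b                             ∎

  module _ {E B : Set} (f : E → B) where

    finSupp : {Ke : List E} {Φ : B → S} (l : List (S × (E → S))) →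
      All (FibreTotals f Ke Φ ∘ proj₂) l → List (S × 𝒮 E)
    finSupp [] [] = []
    finSupp {Ke} ((t , w) ∷ l) ((wKe , _) ∷ good) = (t , mk𝒮 w (λ k → k (Ke , wKe))) ∷ finSupp l good

    sumL-finSupp : {Ke : List E} {Φ : B → S} (l : List (S × (E → S)))
      (good : All (FibreTotals f Ke Φ ∘ proj₂) l) (G : S → (E → S) → S) →
      sumL (finSupp l good) (λ p → G (proj₁ p) (fun (proj₂ p))) ≡ sumL l (λ p → G (proj₁ p) (proj₂ p))
    sumL-finSupp [] [] G = refl
    sumL-finSupp ((t , w) ∷ l) (_ ∷ good) G = cong (G t w +_) (sumL-finSupp l good G)

    finSupp-fibre : {Ke : List E} → Unique Ke → (Φ : 𝒮 B) (l : List (S × (E → S)))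
      (good : All (FibreTotals f Ke (fun Φ) ∘ proj₂) l) →
      All (λ p → 𝒮map f (proj₂ p) ≡ Φ) (finSupp l good)
    finSupp-fibre uKe Φ [] [] = []
    finSupp-fibre {Ke} uKe Φ ((t , w) ∷ l) ((wKe , Σw) ∷ good) =
      𝒮-ext _ _ (λ b → trans (𝒮map-apply f _ b)
                             (trans (∑≡sumL Ke uKe (λ e e∉ → when-0# (f e ≟ b) (wKe e e∉))) (Σw b)))
      ∷ finSupp-fibre uKe Φ l good

  CoversPullback : {A B C P : Set} → (P → A) → (P → B) → (A → C) → (B → C) → Set
  CoversPullback {P = P} p q f g = ∀ a b → f a ≡ g b → Σ P λ z → p z ≡ a × q z ≡ b

  ⟦⟧-intro : {P : Set} → P → ⟦ P ⟧ ≡ true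
  ⟦⟧-intro {P} p with lem {P}
  ... | yes _ = refl
  ... | no ¬p = ⊥-elim (¬p p)

  ⟦⟧-elim : {P : Set} → ⟦ P ⟧ ≡ true → P
  ⟦⟧-elim {P} ⟦P⟧ with lem {P}
  ... | yes p = p
  ... | no _ with ⟦P⟧
  ...   | ()

  ⟦⟧-cong : {P Q : Set} → (P → Q) → (Q → P) → ⟦ P ⟧ ≡ ⟦ Q ⟧
  ⟦⟧-cong {P} {Q} P→Q Q→P with lem {P} | lem {Q}
  ... | yes _ | yes _ = refl
  ... | no _ | no _ = refl
  ... | yes p | no ¬q = ⊥-elim (¬q (P→Q p))
  ... | no ¬p | yes q = ⊥-elim (¬p (Q→P q))

  ∋-set : {X : Set} → ∋ X → 𝒫 X
  ∋-set = proj₁ ∘ proj₁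

  ∋-elem : {X : Set} → ∋ X → X
  ∋-elem = proj₂ ∘ proj₁

  ∋-≡ : {X : Set} {A : 𝒫 X} {x : X} (p q : A x ≡ true) → _≡_ {A = ∋ X} ((A , x) , p) ((A , x) , q)
  ∋-≡ {A = A} {x} p q = cong ((A , x) ,_) (Decidable⇒UIP.≡-irrelevant Bool._≟_ p q)

  ∋map : {X Y : Set} (f : X → Y) → ∋ X → ∋ Y
  ∋map f ((A , x) , x∈A) = (𝒫map f A , f x) , ⟦⟧-intro (x , x∈A , refl)

  Decomposes : {X : Set} → 𝒮 (𝒫 X) → 𝒮 X → Set
  Decomposes {X} Φ φ = Σ (𝒮 (∋ X)) λ ψ → 𝒮map ∋-set ψ ≡ Φ × 𝒮map ∋-elem ψ ≡ φ

  δ-intro : {X : Set} (Φ : 𝒮 (𝒫 X)) (φ : 𝒮 X) → Decomposes Φ φ → δ Φ φ ≡ true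
  δ-intro Φ φ (ψ , set≡Φ , elem≡φ) =
    ⟦⟧-intro (ψ , (λ A → cong (λ χ → fun χ A) (sym set≡Φ)) , (λ x → cong (λ χ → fun χ x) (sym elem≡φ)))

  δ-elim : {X : Set} (Φ : 𝒮 (𝒫 X)) (φ : 𝒮 X) → δ Φ φ ≡ true → Decomposes Φ φ
  δ-elim Φ φ δΦφ =
    let (ψ , Φ≗ , φ≗) = ⟦⟧-elim δΦφ in ψ , 𝒮-ext _ _ (sym ∘ Φ≗) , 𝒮-ext _ _ (sym ∘ φ≗)

  module Positivity (positive : Positive) where

    sumL≡0#⇒0# : {T : Set} (L : List T) (g : T → S) → sumL L g ≡ 0# → ∀ t → t ∈ L → g t ≡ 0#
    sumL≡0#⇒0# (x ∷ L) g sum≡0 t (here refl) = proj₁ (positive _ _ sum≡0)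
    sumL≡0#⇒0# (x ∷ L) g sum≡0 t (there t∈) = sumL≡0#⇒0# L g (proj₂ (positive _ _ sum≡0)) t t∈

    ∑≡0#⇒0# : {T : Set} (g : T → S) (L : List T) → SupportedIn g L → ∑ g ≡ 0# → ∀ t → g t ≡ 0#
    ∑≡0#⇒0# g L gL ∑≡0 t with lem {t ∈ dedup L}
    ... | yes t∈ = sumL≡0#⇒0# (dedup L) g (trans (sym (∑≡sumL-dedup L gL)) ∑≡0) t t∈
    ... | no t∉ = supportedIn-dedup L gL t t∉

  module Refinement (positive : Positive) (refinable : Refinable) where

    open Positivity positive

    refine-sumL : {E : Set} (K : List E) → Unique K → (v : E → S) → SupportedIn v K →
      (x y : S) → x + y ≡ sumL K v →
      Σ (E → S) λ r → Σ (E → S) λ s → HasTotal K x r × HasTotal K y s × (∀ e → r e + s e ≡ v e)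
    refine-sumL [] _ v vK x y x+y≡0 =
      let (x≡0 , y≡0) = positive x y x+y≡0 in
      (λ _ → 0#) , (λ _ → 0#) , ((λ _ _ → refl) , sym x≡0) , ((λ _ _ → refl) , sym y≡0) ,
      (λ e → trans (+-identityˡ 0#) (sym (vK e (λ ()))))
    refine-sumL (k ∷ K) (k∉K ∷ uK) v vK x y x+y≡v =
      let (x₁ , x₂ , y₁ , y₂ , x₁+x₂≡x , y₁+y₂≡y , x₁+y₁≡vk , x₂+y₂≡rest) =
            refinable x y (v k) (sumL K v) x+y≡v
          k∉ = All.All¬⇒¬Any k∉K
          (r , s , (rK , Σr) , (sK , Σs) , r+s≡v) =
            refine-sumL K uK (v [ k ≔ 0# ]) (supportedIn-≔0# v k K vK) x₂ y₂
              (trans x₂+y₂≡rest (sym (sumL-≔-∉ K v k 0# k∉)))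
      in r [ k ≔ x₁ ] , s [ k ≔ y₁ ] ,
         (supportedIn-≔ r k x₁ K rK , trans (sumL-≔-∷ K r k x₁ k∉) (trans (cong (x₁ +_) Σr) x₁+x₂≡x)) ,
         (supportedIn-≔ s k y₁ K sK , trans (sumL-≔-∷ K s k y₁ k∉) (trans (cong (y₁ +_) Σs) y₁+y₂≡y)) ,
         pointwise r s x₁+y₁≡vk r+s≡v
      where
      pointwise : ∀ r s {x₁ y₁} → x₁ + y₁ ≡ v k → (∀ e → r e + s e ≡ (v [ k ≔ 0# ]) e) →
        ∀ e → (r [ k ≔ x₁ ]) e + (s [ k ≔ y₁ ]) e ≡ v e
      pointwise r s {x₁} {y₁} x₁+y₁≡vk r+s≡v e with e ≟ k
      ... | yes refl = x₁+y₁≡vk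
      ... | no e≢k = trans (r+s≡v e) (≔-other v k 0# e e≢k)

    transport : {I E : Set} (R : List I) (w : I → S) (K : List E) → Unique K → (v : E → S) →
      SupportedIn v K → sumL R w ≡ sumL K v → TransportPlan R w K v
    transport [] w K uK v vK 0≡Σv = [] , refl , [] , column
      where
      column : ∀ e → 0# ≡ v e
      column e with lem {e ∈ K}
      ... | yes e∈ = sym (sumL≡0#⇒0# K v (sym 0≡Σv) e e∈)
      ... | no e∉ = sym (vK e e∉)
    transport (i ∷ R) w K uK v vK Σw≡Σv =
      let (r , s , r-row , (sK , Σs) , r+s≡v) = refine-sumL K uK v vK (w i) (sumL R w) Σw≡Σv
          (rows , rows-R , rows-ok , columns) = transport R w K uK s sK (sym Σs)
      in (i , r) ∷ rows , cong (i ∷_) rows-R , r-row ∷ rows-ok ,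
         (λ e → trans (cong (r e +_) (columns e)) (r+s≡v e))

    module PullbackCover {A B C P : Set} (p : P → A) (q : P → B) (f : A → C) (g : B → C)
      (cover : CoversPullback p q f g) (α : 𝒮 A) (β : 𝒮 B) (fα≡gβ : 𝒮map f α ≡ 𝒮map g β) where

      Ua : List A
      Ua = dedup (suppList α)

      Ub : List B
      Ub = dedup (suppList β)

      Uc : List C
      Uc = dedup (map f (suppList α) ++ map g (suppList β))

      αᶜ : C → A → S
      αᶜ c a = when (f a ≟ c) (fun α a)

      βᶜ : C → B → S
      βᶜ c b = when (g b ≟ c) (fun β b)

      αᶜ-supportedIn : ∀ c → SupportedIn (αᶜ c) (suppList α)
      αᶜ-supportedIn c a a∉ = when-0# (f a ≟ c) (suppList-ok α a a∉)

      βᶜ-supportedIn : ∀ c → SupportedIn (βᶜ c) (suppList β)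
      βᶜ-supportedIn c b b∉ = when-0# (g b ≟ c) (suppList-ok β b b∉)

      fibres-balance : ∀ c → sumL Ua (αᶜ c) ≡ sumL Ub (βᶜ c)
      fibres-balance c = begin
        sumL Ua (αᶜ c)     ≡⟨ sym (∑≡sumL-dedup (suppList α) (αᶜ-supportedIn c)) ⟩
        ∑ (αᶜ c)           ≡⟨ sym (𝒮map-apply f α c) ⟩
        fun (𝒮map f α) c   ≡⟨ cong (λ φ → fun φ c) fα≡gβ ⟩
        fun (𝒮map g β) c   ≡⟨ 𝒮map-apply g β c ⟩
        ∑ (βᶜ c)           ≡⟨ ∑≡sumL-dedup (suppList β) (βᶜ-supportedIn c) ⟩
        sumL Ub (βᶜ c)     ∎

      plan : (c : C) → TransportPlan Ua (αᶜ c) Ub (βᶜ c)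
      plan c = transport Ua (αᶜ c) Ub (dedup-unique _) (βᶜ c)
        (supportedIn-dedup _ (βᶜ-supportedIn c)) (fibres-balance c)

      rows : C → List (A × (B → S))
      rows c = proj₁ (plan c)

      row-total : ∀ c r → r ∈ rows c → HasTotal Ub (αᶜ c (proj₁ r)) (proj₂ r)
      row-total c r r∈ = All.lookup (proj₁ (proj₂ (proj₂ (plan c)))) r∈

      column-sum : ∀ c b → sumL (rows c) (λ r → proj₂ r b) ≡ βᶜ c b
      column-sum c b = proj₂ (proj₂ (proj₂ (plan c))) b

      -- Rows outside f⁻¹c and columns outside g⁻¹c have total 0#, so by positivity all their entries vanish.
      plan-in-pullback : ∀ c r → r ∈ rows c → ∀ b → ¬ f (proj₁ r) ≡ g b → proj₂ r b ≡ 0#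
      plan-in-pullback c (a , m) r∈ b fa≢gb with lem {f a ≡ c}
      ... | yes refl = sumL≡0#⇒0# (rows c) (λ r → proj₂ r b)
                         (trans (column-sum c b) (when-no (g b ≟ f a) _ (fa≢gb ∘ sym))) (a , m) r∈
      ... | no fa≢c with lem {b ∈ Ub}
      ...   | no b∉ = proj₁ (row-total c (a , m) r∈) b b∉
      ...   | yes b∈ = sumL≡0#⇒0# Ub m
                         (trans (proj₂ (row-total c (a , m) r∈)) (when-no (f a ≟ c) _ fa≢c)) b b∈

      entry : A → (B → S) → B → List (S × P)
      entry a m b with f a ≟ g b
      ... | yes fa≡gb = [ (m b , proj₁ (cover a b fa≡gb)) ]
      ... | no _ = []

      entriesOver : C → List (S × P)
      entriesOver c = concatMap (λ r → concatMap (entry (proj₁ r) (proj₂ r)) Ub) (rows c)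

      γ : 𝒮 P
      γ = formalSum (concatMap entriesOver Uc)

      𝒮map-γ-apply : {Z : Set} (h : P → Z) (k : A → B → Z) →
        (∀ a b fa≡gb → h (proj₁ (cover a b fa≡gb)) ≡ k a b) → ∀ z →
        fun (𝒮map h γ) z ≡
          sumL Uc (λ c → sumL (rows c) (λ r → sumL Ub (λ b → when (k (proj₁ r) b ≟ z) (proj₂ r b))))
      𝒮map-γ-apply h k h∘cover≡k z = begin
        fun (𝒮map h γ) z
          ≡⟨ 𝒮map-formalSum-apply h (concatMap entriesOver Uc) z ⟩
        sumL (concatMap entriesOver Uc) H
          ≡⟨ sumL-concatMap entriesOver Uc H ⟩
        sumL Uc (λ c → sumL (entriesOver c) H)
          ≡⟨ sumL-cong Uc (λ c _ → trans (sumL-concatMap _ (rows c) H) (sumL-cong (rows c) (λ r r∈ →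
               trans (sumL-concatMap _ Ub H) (sumL-cong Ub (λ b _ → entry-sum c r r∈ b))))) ⟩
        sumL Uc (λ c → sumL (rows c) (λ r → sumL Ub (λ b → when (k (proj₁ r) b ≟ z) (proj₂ r b)))) ∎
        where
        H : S × P → S
        H x = when (h (proj₂ x) ≟ z) (proj₁ x)
        entry-sum : ∀ c r → r ∈ rows c → ∀ b →
          sumL (entry (proj₁ r) (proj₂ r) b) H ≡ when (k (proj₁ r) b ≟ z) (proj₂ r b)
        entry-sum c (a , m) r∈ b with f a ≟ g b
        ... | yes fa≡gb = trans (+-identityʳ _) (cong (λ w → when (w ≟ z) (m b)) (h∘cover≡k a b fa≡gb))
        ... | no fa≢gb = sym (when-0# (k a b ≟ z) (plan-in-pullback c (a , m) r∈ b fa≢gb))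

      rows-index : ∀ c → map proj₁ (rows c) ≡ Ua
      rows-index c = proj₁ (proj₂ (plan c))

      𝒮map-p-γ : 𝒮map p γ ≡ α
      𝒮map-p-γ = 𝒮-ext _ _ pointwise
        where
        pointwise : ∀ a₀ → fun (𝒮map p γ) a₀ ≡ fun α a₀
        pointwise a₀ = begin
          fun (𝒮map p γ) a₀
            ≡⟨ 𝒮map-γ-apply p (λ a _ → a) (λ a b fa≡gb → proj₁ (proj₂ (cover a b fa≡gb))) a₀ ⟩
          sumL Uc (λ c → sumL (rows c) (λ r → sumL Ub (λ b → when (proj₁ r ≟ a₀) (proj₂ r b))))
            ≡⟨ sumL-cong Uc (λ c _ → sumL-cong (rows c) (λ r r∈ →
                 trans (sym (sumL-when (proj₁ r ≟ a₀) Ub (proj₂ r)))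
                       (cong (when (proj₁ r ≟ a₀)) (proj₂ (row-total c r r∈))))) ⟩
          sumL Uc (λ c → sumL (rows c) (λ r → when (proj₁ r ≟ a₀) (αᶜ c (proj₁ r))))
            ≡⟨ sumL-cong Uc (λ c _ → sumL-proj₁ (rows c) Ua (rows-index c) (λ a → when (a ≟ a₀) (αᶜ c a))) ⟩
          sumL Uc (λ c → sumL Ua (λ a → when (a ≟ a₀) (αᶜ c a)))
            ≡⟨ sumL-cong Uc (λ c _ → trans (sym (∑≡sumL-dedup (suppList α) (a₀-vanish c)))
                                           (∑-when≟ʳ a₀ (αᶜ c))) ⟩
          sumL Uc (λ c → αᶜ c a₀)
            ≡⟨ sym (∑≡sumL-dedup _ c-vanish) ⟩
          ∑ (λ c → when (f a₀ ≟ c) (fun α a₀))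
            ≡⟨ ∑-when≟ (f a₀) (λ _ → fun α a₀) ⟩
          fun α a₀ ∎
          where
          a₀-vanish : ∀ c → SupportedIn (λ a → when (a ≟ a₀) (αᶜ c a)) (suppList α)
          a₀-vanish c a a∉ = when-0# (a ≟ a₀) (αᶜ-supportedIn c a a∉)
          c-vanish : SupportedIn (λ c → αᶜ c a₀) (map f (suppList α) ++ map g (suppList β))
          c-vanish c c∉ with f a₀ ≟ c | lem {a₀ ∈ suppList α}
          ... | yes refl | yes a₀∈ = ⊥-elim (c∉ (∈-++⁺ˡ (∈-map⁺ f a₀∈)))
          ... | yes refl | no a₀∉ = suppList-ok α a₀ a₀∉
          ... | no _ | _ = refl

      𝒮map-q-γ : 𝒮map q γ ≡ β
      𝒮map-q-γ = 𝒮-ext _ _ pointwise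
        where
        pointwise : ∀ b₀ → fun (𝒮map q γ) b₀ ≡ fun β b₀
        pointwise b₀ = begin
          fun (𝒮map q γ) b₀
            ≡⟨ 𝒮map-γ-apply q (λ _ b → b) (λ a b fa≡gb → proj₂ (proj₂ (cover a b fa≡gb))) b₀ ⟩
          sumL Uc (λ c → sumL (rows c) (λ r → sumL Ub (λ b → when (b ≟ b₀) (proj₂ r b))))
            ≡⟨ sumL-cong Uc (λ c _ → sumL-cong (rows c) (λ r r∈ →
                 trans (sym (∑≡sumL Ub (dedup-unique _) (b₀-vanish c r r∈))) (∑-when≟ʳ b₀ (proj₂ r)))) ⟩
          sumL Uc (λ c → sumL (rows c) (λ r → proj₂ r b₀))
            ≡⟨ sumL-cong Uc (λ c _ → column-sum c b₀) ⟩
          sumL Uc (λ c → βᶜ c b₀)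
            ≡⟨ sym (∑≡sumL-dedup _ c-vanish) ⟩
          ∑ (λ c → when (g b₀ ≟ c) (fun β b₀))
            ≡⟨ ∑-when≟ (g b₀) (λ _ → fun β b₀) ⟩
          fun β b₀ ∎
          where
          b₀-vanish : ∀ c r → r ∈ rows c → SupportedIn (λ b → when (b ≟ b₀) (proj₂ r b)) Ub
          b₀-vanish c r r∈ b b∉ = when-0# (b ≟ b₀) (proj₁ (row-total c r r∈) b b∉)
          c-vanish : SupportedIn (λ c → βᶜ c b₀) (map f (suppList α) ++ map g (suppList β))
          c-vanish c c∉ with g b₀ ≟ c | lem {b₀ ∈ suppList β}
          ... | yes refl | yes b₀∈ = ⊥-elim (c∉ (∈-++⁺ʳ (map f (suppList α)) (∈-map⁺ g b₀∈)))
          ... | yes refl | no b₀∉ = suppList-ok β b₀ b₀∉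
          ... | no _ | _ = refl

    𝒮-coversPullback : {A B C P : Set} (p : P → A) (q : P → B) (f : A → C) (g : B → C) →
      CoversPullback p q f g → CoversPullback (𝒮map p) (𝒮map q) (𝒮map f) (𝒮map g)
    𝒮-coversPullback p q f g cover α β fα≡gβ = γ , 𝒮map-p-γ , 𝒮map-q-γ
      where open PullbackCover p q f g cover α β fα≡gβ

    Decomposes-map⁺ : {X Y : Set} (f : X → Y) {Φ : 𝒮 (𝒫 X)} {φ : 𝒮 X} →
      Decomposes Φ φ → Decomposes (𝒮map (𝒫map f) Φ) (𝒮map f φ)
    Decomposes-map⁺ f (ψ , set≡Φ , elem≡φ) =
      𝒮map (∋map f) ψ ,
      trans (𝒮map-square (∋map f) ∋-set ∋-set (𝒫map f) ψ (λ _ → refl)) (cong (𝒮map (𝒫map f)) set≡Φ) ,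
      trans (𝒮map-square (∋map f) ∋-elem ∋-elem f ψ (λ _ → refl)) (cong (𝒮map f) elem≡φ)

    ∋map-cover : {X Y : Set} (f : X → Y) → CoversPullback ∋-set (∋map f) (𝒫map f) ∋-set
    ∋map-cover f A ((B , y) , y∈B) refl with ⟦⟧-elim y∈B
    ... | (x , x∈A , refl) = ((A , x) , x∈A) , refl , ∋-≡ _ _

    Decomposes-map⁻ : {X Y : Set} (f : X → Y) {Φ : 𝒮 (𝒫 X)} {φ : 𝒮 Y} →
      Decomposes (𝒮map (𝒫map f) Φ) φ → ∃[ φ′ ] (Decomposes Φ φ′ × 𝒮map f φ′ ≡ φ)
    Decomposes-map⁻ f {Φ} (ψ , set≡fΦ , elem≡φ) =
      let (γ , γ-set , γ-map) = 𝒮-coversPullback ∋-set (∋map f) (𝒫map f) ∋-set (∋map-cover f) Φ ψ (sym set≡fΦ) in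
      𝒮map ∋-elem γ , (γ , γ-set , refl) ,
      trans (𝒮map-square ∋-elem f (∋map f) ∋-elem γ (λ _ → refl)) (trans (cong (𝒮map ∋-elem) γ-map) elem≡φ)

    δ-natural : {X Y : Set} (f : X → Y) (Φ : 𝒮 (𝒫 X)) (φ : 𝒮 Y) →
      𝒫map (𝒮map f) (δ Φ) φ ≡ δ (𝒮map (𝒫map f) Φ) φ
    δ-natural f Φ φ = ⟦⟧-cong (⟦⟧-elim ∘ push) (pull ∘ δ-elim _ _ ∘ ⟦⟧-intro)
      where
      push : ∃[ φ′ ] (δ Φ φ′ ≡ true × 𝒮map f φ′ ≡ φ) → δ (𝒮map (𝒫map f) Φ) φ ≡ true
      push (φ′ , δΦφ′ , refl) = δ-intro _ _ (Decomposes-map⁺ f (δ-elim Φ φ′ δΦφ′))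
      pull : Decomposes (𝒮map (𝒫map f) Φ) φ → ∃[ φ′ ] (δ Φ φ′ ≡ true × 𝒮map f φ′ ≡ φ)
      pull d = let (φ′ , d′ , fφ′≡φ) = Decomposes-map⁻ f d in φ′ , δ-intro _ _ d′ , fφ′≡φ

    Chain : Set → Set
    Chain X = Σ (𝒫 (𝒫 X) × 𝒫 X × X) λ { (𝒜 , A , x) → 𝒜 A ≡ true × A x ≡ true }

    chain-top : {X : Set} → Chain X → 𝒫 (𝒫 X)
    chain-top ((𝒜 , _ , _) , _) = 𝒜

    chain-outer : {X : Set} → Chain X → ∋ (𝒫 X)
    chain-outer ((𝒜 , A , _) , A∈𝒜 , _) = (𝒜 , A) , A∈𝒜

    chain-inner : {X : Set} → Chain X → ∋ X
    chain-inner ((_ , A , x) , _ , x∈A) = (A , x) , x∈A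

    chain-flat : {X : Set} → Chain X → ∋ X
    chain-flat ((𝒜 , A , x) , A∈𝒜 , x∈A) = (μ𝒫 𝒜 , x) , ⟦⟧-intro (A , A∈𝒜 , x∈A)

    chain-flat-cover : {X : Set} → CoversPullback chain-top (chain-flat {X}) μ𝒫 ∋-set
    chain-flat-cover 𝒜 ((B , x) , x∈B) refl with ⟦⟧-elim x∈B
    ... | (A , A∈𝒜 , x∈A) = ((𝒜 , A , x) , A∈𝒜 , x∈A) , refl , ∋-≡ _ _

    chain-cover : {X : Set} → CoversPullback chain-outer (chain-inner {X}) ∋-elem ∋-set
    chain-cover ((𝒜 , A) , A∈𝒜) ((_ , x) , x∈A) refl = ((𝒜 , A , x) , A∈𝒜 , x∈A) , refl , refl

    Decomposes-μ𝒫⁻ : {X : Set} {Ψ : 𝒮 (𝒫 (𝒫 X))} {φ : 𝒮 X} →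
      Decomposes (𝒮map μ𝒫 Ψ) φ → ∃[ Φ ] (Decomposes Ψ Φ × Decomposes Φ φ)
    Decomposes-μ𝒫⁻ {Ψ = Ψ} (ω , set≡μΨ , elem≡φ) =
      let (γ , γ-top , γ-flat) = 𝒮-coversPullback chain-top chain-flat μ𝒫 ∋-set chain-flat-cover Ψ ω (sym set≡μΨ) in
      𝒮map ∋-elem (𝒮map chain-outer γ) ,
      (𝒮map chain-outer γ , trans (𝒮map-∘≗ chain-outer ∋-set chain-top γ (λ _ → refl)) γ-top , refl) ,
      (𝒮map chain-inner γ , 𝒮map-square chain-inner ∋-set chain-outer ∋-elem γ (λ _ → refl) ,
       trans (𝒮map-square chain-inner ∋-elem chain-flat ∋-elem γ (λ _ → refl))
             (trans (cong (𝒮map ∋-elem) γ-flat) elem≡φ))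

    Decomposes-μ𝒫⁺ : {X : Set} {Ψ : 𝒮 (𝒫 (𝒫 X))} {Φ : 𝒮 (𝒫 X)} {φ : 𝒮 X} →
      Decomposes Ψ Φ → Decomposes Φ φ → Decomposes (𝒮map μ𝒫 Ψ) φ
    Decomposes-μ𝒫⁺ (χ , χ-set , χ-elem) (ψ , ψ-set , ψ-elem) =
      let (γ , γ-outer , γ-inner) =
            𝒮-coversPullback chain-outer chain-inner ∋-elem ∋-set chain-cover χ ψ (trans χ-elem (sym ψ-set))
      in 𝒮map chain-flat γ ,
         trans (𝒮map-square chain-flat ∋-set chain-outer (μ𝒫 ∘ ∋-set) γ (λ _ → refl))
           (trans (sym (𝒮map-∘ ∋-set μ𝒫 (𝒮map chain-outer γ)))
             (trans (cong (𝒮map μ𝒫 ∘ 𝒮map ∋-set) γ-outer) (cong (𝒮map μ𝒫) χ-set))) ,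
         trans (𝒮map-square chain-flat ∋-elem chain-inner ∋-elem γ (λ _ → refl))
           (trans (cong (𝒮map ∋-elem) γ-inner) ψ-elem)

    δ-μ𝒫 : {X : Set} (Ψ : 𝒮 (𝒫 (𝒫 X))) (φ : 𝒮 X) → δ (𝒮map μ𝒫 Ψ) φ ≡ μ𝒫 (𝒫map δ (δ Ψ)) φ
    δ-μ𝒫 Ψ φ = ⟦⟧-cong (split ∘ Decomposes-μ𝒫⁻ ∘ δ-elim _ _ ∘ ⟦⟧-intro) (⟦⟧-elim ∘ join)
      where
      split : ∃[ Φ ] (Decomposes Ψ Φ × Decomposes Φ φ) → ∃[ 𝔄 ] (𝒫map δ (δ Ψ) 𝔄 ≡ true × 𝔄 φ ≡ true)
      split (Φ , Ψ→Φ , Φ→φ) = δ Φ , ⟦⟧-intro (Φ , δ-intro _ _ Ψ→Φ , refl) , δ-intro _ _ Φ→φ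
      join : ∃[ 𝔄 ] (𝒫map δ (δ Ψ) 𝔄 ≡ true × 𝔄 φ ≡ true) → δ (𝒮map μ𝒫 Ψ) φ ≡ true
      join (𝔄 , δΨ𝔄 , 𝔄φ) with ⟦⟧-elim δΨ𝔄
      ... | (Φ , δΨΦ , refl) = δ-intro _ _ (Decomposes-μ𝒫⁺ (δ-elim Ψ Φ δΨΦ) (δ-elim Φ φ 𝔄φ))

    singleton : {X : Set} → X → ∋ X
    singleton x = (η𝒫 x , x) , ⟦⟧-intro refl

    SingletonMember : Set → Set
    SingletonMember X = Σ (X × ∋ X) λ { (x , z) → η𝒫 x ≡ ∋-set z }

    singleton-cover : {X : Set} → CoversPullback {P = SingletonMember X} (proj₁ ∘ proj₁) (proj₂ ∘ proj₁) η𝒫 ∋-set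
    singleton-cover x z ηx≡set = ((x , z) , ηx≡set) , refl , refl

    singletonMember-elem : {X : Set} (m : SingletonMember X) → ∋-elem (proj₂ (proj₁ m)) ≡ proj₁ (proj₁ m)
    singletonMember-elem ((x , ((A , y) , y∈A)) , refl) = sym (⟦⟧-elim y∈A)

    Decomposes-η𝒫⁻ : {X : Set} {φ′ φ : 𝒮 X} → Decomposes (𝒮map η𝒫 φ′) φ → φ′ ≡ φ
    Decomposes-η𝒫⁻ {φ′ = φ′} (ψ , set≡ηφ′ , elem≡φ) =
      let (γ , γ-point , γ-member) =
            𝒮-coversPullback (proj₁ ∘ proj₁) (proj₂ ∘ proj₁) η𝒫 ∋-set singleton-cover φ′ ψ (sym set≡ηφ′)
      in trans (sym γ-point)
           (trans (sym (𝒮map-∘≗ (proj₂ ∘ proj₁) ∋-elem (proj₁ ∘ proj₁) γ singletonMember-elem))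
             (trans (cong (𝒮map ∋-elem) γ-member) elem≡φ))

    Decomposes-η𝒫⁺ : {X : Set} (φ : 𝒮 X) → Decomposes (𝒮map η𝒫 φ) φ
    Decomposes-η𝒫⁺ φ =
      𝒮map singleton φ , 𝒮map-∘≗ singleton ∋-set η𝒫 φ (λ _ → refl) ,
      trans (𝒮map-∘≗ singleton ∋-elem (λ x → x) φ (λ _ → refl)) (𝒮map-id φ)

    δ-η𝒫 : {X : Set} (φ′ φ : 𝒮 X) → δ (𝒮map η𝒫 φ′) φ ≡ η𝒫 φ′ φ
    δ-η𝒫 φ′ φ = ⟦⟧-cong (Decomposes-η𝒫⁻ ∘ δ-elim _ _ ∘ ⟦⟧-intro) (⟦⟧-elim ∘ δ-intro _ _ ∘ spread)
      where
      spread : φ′ ≡ φ → Decomposes (𝒮map η𝒫 φ′) φ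
      spread refl = Decomposes-η𝒫⁺ φ′

  module Mixtures (positive : Positive) (refinable : Refinable) (propB : PropB) (propE : PropE) where

    open Positivity positive
    open Refinement positive refinable

    -- Property (E) for sums of any finite length; its base case is (B).
    mixture : {E : Set} (K : List E) → Unique K → (c d : S) (r : E → S) → SupportedIn r K →
      sumL K r ≡ c * d → Mixture (HasTotal K d) c r
    mixture [] _ c d r r0 0≡cd with propB c d (sym 0≡cd)
    ... | inj₁ c≡0 = [] , sym c≡0 , [] , (λ e → sym (r0 e (λ ())))
    ... | inj₂ d≡0 = [ (c , (λ _ → 0#)) ] , +-identityʳ c , ((λ _ _ → refl) , sym d≡0) ∷ [] ,
                     (λ e → trans (cong (_+ 0#) (zeroʳ c)) (trans (+-identityˡ 0#) (sym (r0 e (λ ())))))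
    mixture {E} (k ∷ K) (k∉K ∷ uK) c d r rK Σr≡cd =
      let (t , Σtx≡rk , Σty≡rest , Σt≡c) = propE (r k) (sumL K r) c d Σr≡cd
          plan = transport (supp t) (λ q → fun t q * y q) K uK (r [ k ≔ 0# ]) (supportedIn-≔0# r k K rK)
                   (trans Σty≡rest (sym (sumL-≔-∉ K r k 0# k∉)))
      in mixture-cong Σt≡c (pointwise t Σtx≡rk)
           (mixture-glue (supp t) (fun t) y (λ q → unit (x q)) K (r [ k ≔ 0# ]) (mixture K uK) extend plan)
      where
      k∉ : k ∉ K
      k∉ = All.All¬⇒¬Any k∉K
      x y : Split d → S
      x q = proj₁ (proj₁ q)
      y q = proj₂ (proj₁ q)
      unit : S → E → S
      unit a = (λ _ → 0#) [ k ≔ a ]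
      extend : ∀ q → q ∈ supp _ → ∀ z → HasTotal K (y q) z → HasTotal (k ∷ K) d (λ e → unit (x q) e + z e)
      extend ((xq , yq) , xq+yq≡d) _ z (zK , Σz) =
        (λ e e∉ → trans (cong₂ _+_ (≔-other _ k xq e (λ { refl → e∉ (here refl) })) (zK e (e∉ ∘ there)))
                        (+-identityˡ 0#)) ,
        (begin
          sumL (k ∷ K) (λ e → unit xq e + z e)
            ≡⟨ sumL-+ (k ∷ K) (unit xq) z ⟩
          sumL (k ∷ K) (unit xq) + sumL (k ∷ K) z
            ≡⟨ cong₂ _+_ (sumL-≔-∷ K _ k xq k∉) (cong (_+ sumL K z) (zK k k∉)) ⟩
          (xq + sumL K (λ _ → 0#)) + (0# + sumL K z)
            ≡⟨ cong₂ _+_ (trans (cong (xq +_) (sumL-0# K (λ _ _ → refl))) (+-identityʳ xq))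
                         (trans (+-identityˡ _) Σz) ⟩
          xq + yq
            ≡⟨ xq+yq≡d ⟩
          d ∎)
      pointwise : (t : 𝒮 (Split d)) → sumL (supp t) (λ q → fun t q * x q) ≡ r k →
        ∀ e → sumL (supp t) (λ q → fun t q * unit (x q) e) + (r [ k ≔ 0# ]) e ≡ r e
      pointwise t Σtx≡rk e with e ≟ k
      ... | yes refl = trans (+-identityʳ _) Σtx≡rk
      ... | no _ = trans (cong (_+ r e) (sumL-0# (supp t) (λ q _ → zeroʳ (fun t q)))) (+-identityˡ (r e))

    -- Induction on the base points: the fibre over b is decomposed by mixture and glued to the
    -- decomposition of the other fibres by a transport plan.
    fibreMixture : {E B : Set} (f : E → B) (Lb : List B) → Unique Lb → (Φ : B → S) → SupportedIn Φ Lb →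
      (c : S) (v : E → S) (Ke : List E) → Unique Ke → SupportedIn v Ke → (∀ e → f e ∉ Lb → v e ≡ 0#) →
      (∀ b → sumL Ke (λ e → when (f e ≟ b) (v e)) ≡ c * Φ b) → Mixture (FibreTotals f Ke Φ) c v
    fibreMixture f [] _ Φ Φ0 c v Ke uKe vKe v0 Σv =
      [ (c , (λ _ → 0#)) ] , +-identityʳ c ,
      ((λ _ _ → refl) , (λ b → trans (sumL-0# Ke (λ e _ → when-0# (f e ≟ b) refl)) (sym (Φ0 b (λ ()))))) ∷ [] ,
      (λ e → trans (cong (_+ 0#) (zeroʳ c)) (trans (+-identityˡ 0#) (sym (v0 e (λ ())))))
    fibreMixture {E} f (b ∷ Lb) (_ ∷ uLb) Φ ΦLb c v Ke uKe vKe v0 Σv =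
      mixture-cong Σt pointwise
        (mixture-glue l proj₁ (λ _ → Φ b) proj₂ Kb (onFibre v) (mixture Kb Kb-unique) extend plan)
      where
      open FibreStep f b Ke uKe
      offFibre-vanish : ∀ e → f e ∉ Lb → offFibre v e ≡ 0#
      offFibre-vanish e fe∉ with f e ≟ b
      ... | yes _ = refl
      ... | no fe≢b = v0 e (λ { (here fe≡b) → fe≢b fe≡b ; (there fe∈) → fe∉ fe∈ })
      rest : Mixture (FibreTotals f Ke (Φ [ b ≔ 0# ])) c (offFibre v)
      rest = fibreMixture f Lb uLb (Φ [ b ≔ 0# ]) (supportedIn-≔0# Φ b Lb ΦLb) c (offFibre v) Ke uKe
               (λ e e∉ → unless-0# (f e ≟ b) (vKe e e∉)) offFibre-vanish (offFibre-sums c Φ v Σv)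
      l : List (S × (E → S))
      l = proj₁ rest
      Σt : sumL l proj₁ ≡ c
      Σt = proj₁ (proj₂ rest)
      plan : TransportPlan l (λ i → proj₁ i * Φ b) Kb (onFibre v)
      plan = transport l (λ i → proj₁ i * Φ b) Kb Kb-unique (onFibre v) (onFibre-supportedIn v vKe)
               (trans (sumL-*ʳ l (Φ b) proj₁) (trans (cong (_* Φ b) Σt) (sym (onFibre-sum c Φ v (Σv b)))))
      extend : ∀ i → i ∈ l → ∀ y → HasTotal Kb (Φ b) y → FibreTotals f Ke Φ (λ e → proj₂ i e + y e)
      extend i i∈ y = fibreTotals-shift Φ (proj₂ i) y (All.lookup (proj₁ (proj₂ (proj₂ rest))) i∈)
      pointwise : ∀ e → sumL l (λ i → proj₁ i * proj₂ i e) + onFibre v e ≡ v e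
      pointwise e = trans (cong (_+ onFibre v e) (proj₂ (proj₂ (proj₂ rest)) e)) (unless+when (f e ≟ b) (v e))

    decompose-over-fibre : {E B : Set} (f : E → B) (Φ : 𝒮 B) (c : S) (v : 𝒮 E) → (∀ b → fun (𝒮map f v) b ≡ c * fun Φ b) →
      Σ (List (S × 𝒮 E)) λ l → sumL l proj₁ ≡ c × All (λ p → 𝒮map f (proj₂ p) ≡ Φ) l ×
        (∀ e → sumL l (λ p → proj₁ p * fun (proj₂ p) e) ≡ fun v e)
    decompose-over-fibre {E} {B} f Φ c v fv≡cΦ =
      let (l , Σt , good , Σtw) = fibreMixture f Lb (dedup-unique _) (fun Φ) ΦLb c (fun v) Ke (dedup-unique _)
                                    (supportedIn-dedup _ (suppList-ok v)) v-vanish fibre-sums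
      in finSupp f l good , trans (sumL-finSupp f l good (λ t _ → t)) Σt , finSupp-fibre f (dedup-unique _) Φ l good ,
         (λ e → trans (sumL-finSupp f l good (λ t w → t * w e)) (Σtw e))
      where
      Ke : List E
      Ke = dedup (suppList v)
      Lb : List B
      Lb = dedup (suppList Φ ++ map f (suppList v))
      ΦLb : SupportedIn (fun Φ) Lb
      ΦLb = supportedIn-dedup _ (λ b b∉ → suppList-ok Φ b (b∉ ∘ ∈-++⁺ˡ))
      v-vanish : ∀ e → f e ∉ Lb → fun v e ≡ 0#
      v-vanish e fe∉ with lem {e ∈ suppList v}
      ... | yes e∈ = ⊥-elim (fe∉ (∈-deduplicate⁺ _≟_ (∈-++⁺ʳ (suppList Φ) (∈-map⁺ f e∈))))
      ... | no e∉ = suppList-ok v e e∉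
      fibre-sums : ∀ b → sumL Ke (λ e → when (f e ≟ b) (fun v e)) ≡ c * fun Φ b
      fibre-sums b = trans (sym (∑≡sumL-dedup (suppList v) (λ e e∉ → when-0# (f e ≟ b) (suppList-ok v e e∉))))
                           (trans (sym (𝒮map-apply f v b)) (fv≡cΦ b))

    -- α(Φ , b) = Ψ(Φ)·Φ(b) lies over μΨ = 𝒮f ω; covering the pullback of proj₂ and f cuts ω into
    -- slices with 𝒮f (slice Φ) = Ψ(Φ)·Φ, and each slice decomposes over the fibre of 𝒮f above Φ.
    module NaturalityOfμCover {E B : Set} (f : E → B) (ω : 𝒮 E) (Ψ : 𝒮 (𝒮 B))
      (fω≡μΨ : 𝒮map f ω ≡ μ𝒮 Ψ) where

      tag : 𝒮 B → 𝒮 (𝒮 B × B)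
      tag Φ = 𝒮map (Φ ,_) Φ

      α : 𝒮 (𝒮 B × B)
      α = μ𝒮 (𝒮map tag Ψ)

      tag-apply : ∀ Φ′ Φ b → fun (tag Φ′) (Φ , b) ≡ when (Φ′ ≟ Φ) (fun Φ′ b)
      tag-apply Φ′ Φ b = begin
        fun (tag Φ′) (Φ , b)
          ≡⟨ 𝒮map-apply (Φ′ ,_) Φ′ (Φ , b) ⟩
        ∑ (λ b′ → when ((Φ′ , b′) ≟ (Φ , b)) (fun Φ′ b′))
          ≡⟨ ∑-cong (λ b′ → when-× Φ′ Φ b′ b _) ⟩
        ∑ (λ b′ → when (Φ′ ≟ Φ) (when (b′ ≟ b) (fun Φ′ b′)))
          ≡⟨ sym (∑-when (Φ′ ≟ Φ) _) ⟩
        when (Φ′ ≟ Φ) (∑ (λ b′ → when (b′ ≟ b) (fun Φ′ b′)))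
          ≡⟨ cong (when (Φ′ ≟ Φ)) (∑-when≟ʳ b (fun Φ′)) ⟩
        when (Φ′ ≟ Φ) (fun Φ′ b) ∎

      α-apply : ∀ Φ b → fun α (Φ , b) ≡ fun Ψ Φ * fun Φ b
      α-apply Φ b = begin
        fun α (Φ , b)
          ≡⟨ μ𝒮-apply _ (Φ , b) ⟩
        ∑ (λ χ → fun (𝒮map tag Ψ) χ * fun χ (Φ , b))
          ≡⟨ ∑-𝒮map tag Ψ (λ χ → fun χ (Φ , b)) ⟩
        ∑ (λ Φ′ → fun Ψ Φ′ * fun (tag Φ′) (Φ , b))
          ≡⟨ ∑-cong (λ Φ′ → trans (cong (fun Ψ Φ′ *_) (tag-apply Φ′ Φ b)) (sym (when-*ʳ (Φ′ ≟ Φ) _ _))) ⟩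
        ∑ (λ Φ′ → when (Φ′ ≟ Φ) (fun Ψ Φ′ * fun Φ′ b))
          ≡⟨ ∑-when≟ʳ Φ (λ Φ′ → fun Ψ Φ′ * fun Φ′ b) ⟩
        fun Ψ Φ * fun Φ b ∎

      𝒮map-proj₂-α : 𝒮map proj₂ α ≡ 𝒮map f ω
      𝒮map-proj₂-α = begin
        𝒮map proj₂ (μ𝒮 (𝒮map tag Ψ))               ≡⟨ μ𝒮-natural proj₂ _ ⟩
        μ𝒮 (𝒮map (𝒮map proj₂) (𝒮map tag Ψ))        ≡⟨ cong μ𝒮 (𝒮map-∘≗ tag (𝒮map proj₂) (λ Φ → Φ) Ψ untag) ⟩
        μ𝒮 (𝒮map (λ Φ → Φ) Ψ)                       ≡⟨ cong μ𝒮 (𝒮map-id Ψ) ⟩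
        μ𝒮 Ψ                                         ≡⟨ sym fω≡μΨ ⟩
        𝒮map f ω                                     ∎
        where
        untag : ∀ Φ → 𝒮map proj₂ (tag Φ) ≡ Φ
        untag Φ = trans (𝒮map-∘ (Φ ,_) proj₂ Φ) (𝒮map-id Φ)

      lift : 𝒮 B × E → 𝒮 B × B
      lift (Φ , e) = Φ , f e

      lift-cover : CoversPullback lift proj₂ proj₂ f
      lift-cover (Φ , _) e refl = (Φ , e) , refl , refl

      γ-cover : Σ (𝒮 (𝒮 B × E)) λ γ → 𝒮map lift γ ≡ α × 𝒮map proj₂ γ ≡ ω
      γ-cover = 𝒮-coversPullback lift proj₂ proj₂ f lift-cover α ω 𝒮map-proj₂-α

      γ : 𝒮 (𝒮 B × E)
      γ = proj₁ γ-cover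

      slice-supportedIn : ∀ Φ → SupportedIn (λ e → fun γ (Φ , e)) (map proj₂ (suppList γ))
      slice-supportedIn Φ e e∉ = suppList-ok γ (Φ , e) (e∉ ∘ ∈-map⁺ proj₂)

      slice : 𝒮 B → 𝒮 E
      slice Φ = mk𝒮 (λ e → fun γ (Φ , e)) (λ k → k (map proj₂ (suppList γ) , slice-supportedIn Φ))

      𝒮map-f-slice : ∀ Φ b → fun (𝒮map f (slice Φ)) b ≡ fun Ψ Φ * fun Φ b
      𝒮map-f-slice Φ b = begin
        fun (𝒮map f (slice Φ)) b
          ≡⟨ 𝒮map-apply f _ b ⟩
        ∑ (λ e → when (f e ≟ b) (fun γ (Φ , e)))
          ≡⟨ sym (∑-when-proj₁≟ Φ (λ Φe → when (f (proj₂ Φe) ≟ b) (fun γ Φe)) (map proj₂ (suppList γ))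
                    (λ e e∉ → when-0# _ (slice-supportedIn Φ e e∉))) ⟩
        ∑ (λ Φe → when (proj₁ Φe ≟ Φ) (when (f (proj₂ Φe) ≟ b) (fun γ Φe)))
          ≡⟨ sym (∑-cong (λ Φe → when-× (proj₁ Φe) Φ (f (proj₂ Φe)) b (fun γ Φe))) ⟩
        ∑ (λ Φe → when (lift Φe ≟ (Φ , b)) (fun γ Φe))
          ≡⟨ sym (𝒮map-apply lift γ (Φ , b)) ⟩
        fun (𝒮map lift γ) (Φ , b)
          ≡⟨ cong (λ φ → fun φ (Φ , b)) (proj₁ (proj₂ γ-cover)) ⟩
        fun α (Φ , b)
          ≡⟨ α-apply Φ b ⟩
        fun Ψ Φ * fun Φ b ∎

      ∑-slices : ∀ e → ∑ (λ Φ → fun γ (Φ , e)) ≡ fun ω e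
      ∑-slices e = begin
        ∑ (λ Φ → fun γ (Φ , e))
          ≡⟨ sym (∑-when-proj₂≟ e (fun γ) (map proj₁ (suppList γ))
                   (λ Φ Φ∉ → suppList-ok γ (Φ , e) (Φ∉ ∘ ∈-map⁺ proj₁))) ⟩
        ∑ (λ Φe → when (proj₂ Φe ≟ e) (fun γ Φe))
          ≡⟨ sym (𝒮map-apply proj₂ γ e) ⟩
        fun (𝒮map proj₂ γ) e
          ≡⟨ cong (λ φ → fun φ e) (proj₂ (proj₂ γ-cover)) ⟩
        fun ω e ∎

      slice-vanish : ∀ Φ → fun Ψ Φ ≡ 0# → ∀ e → fun γ (Φ , e) ≡ 0#
      slice-vanish Φ ΨΦ≡0 e = trans (sym (when-yes (f e ≟ f e) _ refl))
        (∑≡0#⇒0# (λ e′ → when (f e′ ≟ f e) (fun γ (Φ , e′))) (map proj₂ (suppList γ))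
          (λ e′ e′∉ → when-0# _ (slice-supportedIn Φ e′ e′∉))
          (trans (sym (𝒮map-apply f (slice Φ) (f e)))
            (trans (𝒮map-f-slice Φ (f e)) (trans (cong (_* _) ΨΦ≡0) (zeroˡ _))))
          e)

      UΨ : List (𝒮 B)
      UΨ = dedup (suppList Ψ)

      ∑Ψ≡sumL : (g : 𝒮 B → S) → (∀ Φ → fun Ψ Φ ≡ 0# → g Φ ≡ 0#) → ∑ g ≡ sumL UΨ g
      ∑Ψ≡sumL g g0 = ∑≡sumL UΨ (dedup-unique _) (supportedIn-dedup _ (λ Φ Φ∉ → g0 Φ (suppList-ok Ψ Φ Φ∉)))

      pieces : 𝒮 B → List (S × 𝒮 E)
      pieces Φ = proj₁ (decompose-over-fibre f Φ (fun Ψ Φ) (slice Φ) (𝒮map-f-slice Φ))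

      Ω : 𝒮 (𝒮 E)
      Ω = formalSum (concatMap pieces UΨ)

      μΩ≡ω : μ𝒮 Ω ≡ ω
      μΩ≡ω = 𝒮-ext _ _ λ e → begin
        fun (μ𝒮 Ω) e
          ≡⟨ μ𝒮-formalSum (concatMap pieces UΨ) e ⟩
        sumL (concatMap pieces UΨ) (λ p → proj₁ p * fun (proj₂ p) e)
          ≡⟨ sumL-concatMap pieces UΨ _ ⟩
        sumL UΨ (λ Φ → sumL (pieces Φ) (λ p → proj₁ p * fun (proj₂ p) e))
          ≡⟨ sumL-cong UΨ (λ Φ _ → proj₂ (proj₂ (proj₂ (decompose-over-fibre f Φ _ _ (𝒮map-f-slice Φ)))) e) ⟩
        sumL UΨ (λ Φ → fun γ (Φ , e))
          ≡⟨ sym (∑Ψ≡sumL _ (λ Φ ΨΦ≡0 → slice-vanish Φ ΨΦ≡0 e)) ⟩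
        ∑ (λ Φ → fun γ (Φ , e))
          ≡⟨ ∑-slices e ⟩
        fun ω e ∎

      𝒮map-𝒮map-f-Ω : 𝒮map (𝒮map f) Ω ≡ Ψ
      𝒮map-𝒮map-f-Ω = 𝒮-ext _ _ λ χ → begin
        fun (𝒮map (𝒮map f) Ω) χ
          ≡⟨ 𝒮map-formalSum-apply (𝒮map f) (concatMap pieces UΨ) χ ⟩
        sumL (concatMap pieces UΨ) (λ p → when (𝒮map f (proj₂ p) ≟ χ) (proj₁ p))
          ≡⟨ sumL-concatMap pieces UΨ _ ⟩
        sumL UΨ (λ Φ → sumL (pieces Φ) (λ p → when (𝒮map f (proj₂ p) ≟ χ) (proj₁ p)))
          ≡⟨ sumL-cong UΨ (λ Φ _ → pieces-over Φ χ) ⟩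
        sumL UΨ (λ Φ → when (Φ ≟ χ) (fun Ψ Φ))
          ≡⟨ sym (∑Ψ≡sumL _ (λ Φ ΨΦ≡0 → when-0# (Φ ≟ χ) ΨΦ≡0)) ⟩
        ∑ (λ Φ → when (Φ ≟ χ) (fun Ψ Φ))
          ≡⟨ ∑-when≟ʳ χ (fun Ψ) ⟩
        fun Ψ χ ∎
        where
        pieces-over : ∀ Φ χ →
          sumL (pieces Φ) (λ p → when (𝒮map f (proj₂ p) ≟ χ) (proj₁ p)) ≡ when (Φ ≟ χ) (fun Ψ Φ)
        pieces-over Φ χ =
          let (_ , Σt , fibre , _) = decompose-over-fibre f Φ (fun Ψ Φ) (slice Φ) (𝒮map-f-slice Φ) in
          trans (sumL-cong (pieces Φ) (λ p p∈ → cong (λ φ → when (φ ≟ χ) (proj₁ p)) (All.lookup fibre p∈)))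
                (trans (sym (sumL-when (Φ ≟ χ) (pieces Φ) proj₁)) (cong (when (Φ ≟ χ)) Σt))

    μ𝒮-coversNaturalitySquare : {E B : Set} (f : E → B) →
      CoversPullback μ𝒮 (𝒮map (𝒮map f)) (𝒮map f) μ𝒮
    μ𝒮-coversNaturalitySquare f ω Ψ fω≡μΨ = Ω , μΩ≡ω , 𝒮map-𝒮map-f-Ω
      where open NaturalityOfμCover f ω Ψ fω≡μΨ

    DecomposedPair : Set → Set
    DecomposedPair X = Σ (𝒮 (𝒫 X) × 𝒮 X) λ { (Φ , φ) → δ Φ φ ≡ true }

    pair-δ : {X : Set} → DecomposedPair X → ∋ (𝒮 X)
    pair-δ ((Φ , φ) , δΦφ) = (δ Φ , φ) , δΦφ

    witness : {X : Set} → DecomposedPair X → 𝒮 (∋ X)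
    witness ((Φ , φ) , δΦφ) = proj₁ (δ-elim Φ φ δΦφ)

    marginals : {X : Set} → 𝒮 (∋ X) → ∋ (𝒮 X)
    marginals ψ = (δ (𝒮map ∋-set ψ) , 𝒮map ∋-elem ψ) , δ-intro _ _ (ψ , refl , refl)

    pair-cover : {X : Set} → CoversPullback (proj₁ ∘ proj₁) (pair-δ {X}) δ ∋-set
    pair-cover Φ ((_ , ξ) , δΦξ) refl = ((Φ , ξ) , δΦξ) , refl , refl

    witness-set : {X : Set} (p : DecomposedPair X) → 𝒮map ∋-set (witness p) ≡ proj₁ (proj₁ p)
    witness-set ((Φ , φ) , δΦφ) = proj₁ (proj₂ (δ-elim Φ φ δΦφ))

    witness-elem : {X : Set} (p : DecomposedPair X) → 𝒮map ∋-elem (witness p) ≡ ∋-elem (pair-δ p)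
    witness-elem ((Φ , φ) , δΦφ) = proj₂ (proj₂ (δ-elim Φ φ δΦφ))

    Decomposes-μ𝒮⁻ : {X : Set} {Ψ : 𝒮 (𝒮 (𝒫 X))} {φ : 𝒮 X} →
      Decomposes (μ𝒮 Ψ) φ → ∃[ Ξ ] (Decomposes (𝒮map δ Ψ) Ξ × μ𝒮 Ξ ≡ φ)
    Decomposes-μ𝒮⁻ {Ψ = Ψ} {φ} (ω , set≡μΨ , elem≡φ) =
      let (Ω , μΩ≡ω , setΩ≡Ψ) = μ𝒮-coversNaturalitySquare ∋-set ω Ψ set≡μΨ in
      𝒮map ∋-elem (𝒮map marginals Ω) ,
      (𝒮map marginals Ω ,
       trans (𝒮map-square marginals ∋-set (𝒮map ∋-set) δ Ω (λ _ → refl)) (cong (𝒮map δ) setΩ≡Ψ) ,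
       refl) ,
      (begin
        μ𝒮 (𝒮map ∋-elem (𝒮map marginals Ω)) ≡⟨ cong μ𝒮 (𝒮map-∘≗ marginals ∋-elem (𝒮map ∋-elem) Ω (λ _ → refl)) ⟩
        μ𝒮 (𝒮map (𝒮map ∋-elem) Ω)           ≡⟨ sym (μ𝒮-natural ∋-elem Ω) ⟩
        𝒮map ∋-elem (μ𝒮 Ω)                  ≡⟨ cong (𝒮map ∋-elem) μΩ≡ω ⟩
        𝒮map ∋-elem ω                       ≡⟨ elem≡φ ⟩
        φ                                    ∎)

    Decomposes-μ𝒮⁺ : {X : Set} {Ψ : 𝒮 (𝒮 (𝒫 X))} {Ξ : 𝒮 (𝒮 X)} →
      Decomposes (𝒮map δ Ψ) Ξ → Decomposes (μ𝒮 Ψ) (μ𝒮 Ξ)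
    Decomposes-μ𝒮⁺ {Ψ = Ψ} {Ξ} (ρ , set≡δΨ , elem≡Ξ) =
      let (γ , γ-Ψ , γ-ρ) = 𝒮-coversPullback (proj₁ ∘ proj₁) pair-δ δ ∋-set pair-cover Ψ ρ (sym set≡δΨ) in
      μ𝒮 (𝒮map witness γ) ,
      (begin
        𝒮map ∋-set (μ𝒮 (𝒮map witness γ))         ≡⟨ μ𝒮-natural ∋-set _ ⟩
        μ𝒮 (𝒮map (𝒮map ∋-set) (𝒮map witness γ)) ≡⟨ cong μ𝒮 (𝒮map-∘≗ witness (𝒮map ∋-set) _ γ witness-set) ⟩
        μ𝒮 (𝒮map (proj₁ ∘ proj₁) γ)               ≡⟨ cong μ𝒮 γ-Ψ ⟩
        μ𝒮 Ψ                                      ∎) ,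
      (begin
        𝒮map ∋-elem (μ𝒮 (𝒮map witness γ))
          ≡⟨ μ𝒮-natural ∋-elem _ ⟩
        μ𝒮 (𝒮map (𝒮map ∋-elem) (𝒮map witness γ))
          ≡⟨ cong μ𝒮 (𝒮map-square witness (𝒮map ∋-elem) pair-δ ∋-elem γ witness-elem) ⟩
        μ𝒮 (𝒮map ∋-elem (𝒮map pair-δ γ))
          ≡⟨ cong (μ𝒮 ∘ 𝒮map ∋-elem) γ-ρ ⟩
        μ𝒮 (𝒮map ∋-elem ρ)
          ≡⟨ cong μ𝒮 elem≡Ξ ⟩
        μ𝒮 Ξ ∎)

    δ-μ𝒮 : {X : Set} (Ψ : 𝒮 (𝒮 (𝒫 X))) (φ : 𝒮 X) → δ (μ𝒮 Ψ) φ ≡ 𝒫map μ𝒮 (δ (𝒮map δ Ψ)) φ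
    δ-μ𝒮 Ψ φ = ⟦⟧-cong (split ∘ Decomposes-μ𝒮⁻ ∘ δ-elim _ _ ∘ ⟦⟧-intro) (⟦⟧-elim ∘ join)
      where
      split : ∃[ Ξ ] (Decomposes (𝒮map δ Ψ) Ξ × μ𝒮 Ξ ≡ φ) → ∃[ Ξ ] (δ (𝒮map δ Ψ) Ξ ≡ true × μ𝒮 Ξ ≡ φ)
      split (Ξ , d , μΞ≡φ) = Ξ , δ-intro _ _ d , μΞ≡φ
      join : ∃[ Ξ ] (δ (𝒮map δ Ψ) Ξ ≡ true × μ𝒮 Ξ ≡ φ) → δ (μ𝒮 Ψ) φ ≡ true
      join (Ξ , δΨΞ , refl) = δ-intro _ _ (Decomposes-μ𝒮⁺ (δ-elim _ Ξ δΨΞ))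

    δ-isWeakDistributiveLaw : IsWeakDistributiveLaw δ
    δ-isWeakDistributiveLaw = record
      { natural = δ-natural
      ; law-μ𝒫 = δ-μ𝒫
      ; law-μ𝒮 = δ-μ𝒮
      ; law-η𝒫 = δ-η𝒫
      }

theorem3p1 : {S : Set} {_+_ _*_ : Op₂ S} {0# 1# : S}
    (isSR : IsSemiring _≡_ _+_ _*_ 0# 1#)
    (lem : ExcludedMiddle 0ℓ) (funext : Extensionality 0ℓ 0ℓ) →
    let open Semiring-Monads isSR lem in
    Positive → Refinable → PropB → PropE →
    IsWeakDistributiveLaw δ
theorem3p1 isSR lem funext positive refinable propB propE =
  WeakDistributiveLaw.Mixtures.δ-isWeakDistributiveLaw isSR lem funext positive refinable propB propE
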